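{- For every integer $r\ge1$, $$\alpha_r=\frac{(-1)^r}{2^r(2r-1)!!}\sum_{l=0}^{r}\binom{2r}{2l}\frac{(2l)!}{(-240)^l\,l!}\big(h(-2)+h(-1)\big)^{2(r-l)}\mathbf 1,$$ where $\alpha_r=\frac{(-1)^r}{2^r(2r-1)!!}h[-2]^{2r}\mathbf 1$.
   Context: $S=\mathbb{Q}[h(-1),h(-2),\dots]\mathbf 1$ is the Heisenberg vertex operator algebra of central charge $1$: $h(-n)$ ($n\ge1$) acts by multiplication, $h(n)$ acts as $n\,\partial/\partial h(-n)$, $h(0)=0$. Zhu's square-bracket mode $h[-2]=\mathrm{Res}_z\,Y(h(-1)\mathbf 1,e^z-1)e^zz^{ -2}$ has the expansion $h[-2]=h(-2)+h(-1)-\frac1{240}h(2)+\frac1{240}h(3)-\cdots$ (further terms involve $h(k)$, $k\ge4$). $(2r-1)!!$ is the product of odd integers up to $2r-1$. -}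

module Defs where

open import Data.Nat as ℕ using (ℕ; zero; suc; _∸_; _⊔_; _!)
open import Data.Nat.Combinatorics using (_C_)
open import Data.Integer as ℤ using (ℤ)
open import Data.Rational as ℚ using (ℚ; 0ℚ; 1ℚ; _+_; _*_; -_; _/_)
open import Data.List as List using (List; []; _∷_; map; foldr; _++_; length; concatMap; upTo)
open import Data.Product using (_×_; _,_)
open import Data.Bool using (Bool; true; false; if_then_else_)
open import Relation.Binary.PropositionalEquality using (_≡_)
open import Relation.Nullary.Decidable using (⌊_⌋)
open import Data.List.Properties using (≡-dec)

fromℕ : ℕ → ℚ
fromℕ n = ℤ.+ n / 1

-- 1/n for n ≥ 1 (and 0 for n = 0; only ever used with n ≥ 1)
invNat : ℕ → ℚ
invNat zero    = 0ℚ
invNat (suc n) = ℤ.+ 1 / suc n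

negOnePow : ℕ → ℚ
negOnePow zero    = 1ℚ
negOnePow (suc n) = - negOnePow n

oddFact : ℕ → ℕ
oddFact zero    = 1
oddFact (suc r) = oddFact r ℕ.* (2 ℕ.* r ℕ.+ 1)

-- Formal power series over ℚ (coefficient functions), used to compute
-- the coefficients of Zhu's mode h[-2].

PS : Set
PS = ℕ → ℚ

sumTo : (ℕ → ℚ) → ℕ → ℚ
sumTo f zero    = f 0
sumTo f (suc n) = sumTo f n + f (suc n)

_⊛_ : PS → PS → PS
(f ⊛ g) n = sumTo (λ i → f i * g (n ∸ i)) n

oneS : PS
oneS zero    = 1ℚ
oneS (suc _) = 0ℚ

powS : PS → ℕ → PS
powS f zero    = oneS
powS f (suc k) = f ⊛ powS f k

expS : PS
expS k = invNat (k !)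

expm1S : PS
expm1S zero    = 0ℚ
expm1S (suc k) = invNat (suc k !)

expm1OverZ : PS
expm1OverZ k = invNat (suc k !)

-- coefficients b_n, …, b_0 (reversed) of the multiplicative inverse of a
-- power series a with a 0 = 1:  b_0 = 1,  b_n = - Σ_{i=1}^{n} a_i b_{n-i}.
invUpTo : PS → ℕ → List ℚ
invUpTo a zero    = 1ℚ ∷ []
invUpTo a (suc n) = (- dot 1 bs) ∷ bs
  where
  bs = invUpTo a n
  -- bs = b_n ∷ … ∷ b_0 ; dot i (b_{n+1-i} ∷ …) = Σ_j a_j b_{n+1-j}, j ≥ i
  dot : ℕ → List ℚ → ℚ
  dot i []       = 0ℚ
  dot i (b ∷ xs) = a i * b + dot (suc i) xs

headQ : List ℚ → ℚ
headQ []      = 0ℚ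
headQ (x ∷ _) = x

-- z/(e^z - 1) = ((e^z - 1)/z)^{-1}
toddS : PS
toddS k = headQ (invUpTo expm1OverZ k)

-- Zhu's mode:  h[-2] = Res_z Y(h(-1)1, e^z - 1) e^z z^{-2}
--                    = Σ_{n ∈ ℤ} c_n h(n),
--   c_n = [z^1] ( (e^z - 1)^{-n-1} e^z ).
-- For n = -(m+1), m ≥ 0:  c_{-(m+1)} = [z^1] ((e^z-1)^m e^z).
cNeg : ℕ → ℚ
cNeg m = (powS expm1S m ⊛ expS) 1

-- For n ≥ 0:  (e^z-1)^{-n-1} = z^{-n-1} (z/(e^z-1))^{n+1}, so
--   c_n = [z^{n+2}] ( (z/(e^z-1))^{n+1} e^z ).
cPos : ℕ → ℚ
cPos n = (powS toddS (suc n) ⊛ expS) (suc (suc n))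

-- The Heisenberg VOA  S = ℚ[h(-1), h(-2), …] 1.
-- A monomial is the list of exponents (e₁, e₂, …) of h(-1), h(-2), …
-- (trailing zeros are irrelevant); a polynomial is a finite formal sum
-- of (coefficient , monomial) pairs.

Mono : Set
Mono = List ℕ

Poly : Set
Poly = List (ℚ × Mono)

trim : Mono → Mono
trim []      = []
trim (e ∷ m) = cons e (trim m)
  where
  cons : ℕ → Mono → Mono
  cons zero    [] = []
  cons (suc e) [] = suc e ∷ []
  cons e (x ∷ xs) = e ∷ x ∷ xs

coeff : Poly → Mono → ℚ
coeff []              m = 0ℚ
coeff ((c , m') ∷ p) m =
  (if ⌊ ≡-dec ℕ._≟_ (trim m') (trim m) ⌋ then c else 0ℚ) + coeff p m

infix 4 _≈S_
_≈S_ : Poly → Poly → Set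
p ≈S q = ∀ m → coeff p m ≡ coeff q m

vac : Poly
vac = (1ℚ , []) ∷ []

scale : ℚ → Poly → Poly
scale c = map (λ { (a , m) → (c * a , m) })

incAt : ℕ → Mono → Mono
incAt zero    []      = 1 ∷ []
incAt zero    (e ∷ m) = suc e ∷ m
incAt (suc k) []      = 0 ∷ incAt k []
incAt (suc k) (e ∷ m) = e ∷ incAt k m

expAt : ℕ → Mono → ℕ
expAt k       []      = 0
expAt zero    (e ∷ m) = e
expAt (suc k) (e ∷ m) = expAt k m

decAt : ℕ → Mono → Mono
decAt k       []      = []
decAt zero    (e ∷ m) = e ∸ 1 ∷ m
decAt (suc k) (e ∷ m) = e ∷ decAt k m

-- ∂/∂h(-(k+1))
deriv : ℕ → Poly → Poly
deriv k = map (λ { (a , m) → (a * fromℕ (expAt k m) , decAt k m) })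

-- h(-n) for n ≥ 0 (multiplication by h(-n); h(0) = 0)
hMinus : ℕ → Poly → Poly
hMinus zero    p = []
hMinus (suc k) p = map (λ { (a , m) → (a , incAt k m) }) p

-- h(n) for n ≥ 0 (h(n) = n ∂/∂h(-n); h(0) = 0)
hPlus : ℕ → Poly → Poly
hPlus zero    p = []
hPlus (suc k) p = scale (fromℕ (suc k)) (deriv k p)

-- number of variables occurring: h(n) p = 0 for n > varBound p
varBound : Poly → ℕ
varBound = foldr (λ { (_ , m) acc → length m ⊔ acc }) 0

-- h[-2] acting on S.  Modes h(n), n > varBound p, annihilate p; the
-- coefficients c_{-(m+1)} vanish for m ≥ 2 (and all such terms are
-- included up to m ≤ varBound p + 1 anyway).
hBr2 : Poly → Poly
hBr2 p =
  concatMap (λ m → scale (cNeg m) (hMinus (suc m) p)) (upTo (suc (suc L)))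
  ++ concatMap (λ n → scale (cPos (suc n)) (hPlus (suc n) p)) (upTo L)
  where L = varBound p

hSum : Poly → Poly
hSum p = hMinus 2 p ++ hMinus 1 p

iter : (Poly → Poly) → ℕ → Poly → Poly
iter f zero    p = p
iter f (suc k) p = f (iter f k p)

pref : ℕ → ℚ
pref r = negOnePow r * invNat (2 ℕ.^ r ℕ.* oddFact r)

alpha : ℕ → Poly
alpha r = scale (pref r) (iter hBr2 (2 ℕ.* r) vac)

rhsCoeff : ℕ → ℕ → ℚ
rhsCoeff r l =
  fromℕ (((2 ℕ.* r) C (2 ℕ.* l)) ℕ.* (2 ℕ.* l) !)
  * (negOnePow l * invNat (240 ℕ.^ l ℕ.* l !))

rhs : ℕ → Poly
rhs r = scale (pref r)
  (concatMap (λ l → scale (rhsCoeff r l) (iter hSum (2 ℕ.* (r ∸ l)) vac))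
             (upTo (suc r)))

-- On ℚ[h(-1), h(-2)] the modes h(n) with n ≥ 3 act by zero, h(1) enters h[-2] with coefficient 0,
-- and the coefficients of h(-n), n ≥ 3, vanish since (e^z - 1)^(n-1) = O(z^(n-1)).  So there h[-2]
-- acts as multiplication by u = h(-1) + h(-2) plus κ ∂/∂h(-2), where κ = 2·(-1/240) = -1/120.
-- On polynomials in u the derivation ∂/∂h(-2) is d/du, so h[-2]ⁿ 1 = Hₙ(u) with H₀ = 1 and
-- Hₙ₊₁ = u Hₙ + κ Hₙ′, a rescaled Hermite polynomial: its coefficient of u^(2r-2l) in H₂ᵣ is
-- C(2r,2l) (2l-1)!! κˡ (choose the 2l factors hit by d/du and pair them), and
-- (2l-1)!! = (2l)!/(2ˡ l!) turns this into the coefficient on the right-hand side.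
-- Both sides are compared through their coefficients of h(-1)ᵃ h(-2)ᵇ, which for uʲ is
-- C(a+b, b) if j = a + b.

module Submission where

open import Defs
open import Data.Bool using (Bool; true; false; if_then_else_; T)
open import Data.Empty using (⊥-elim)
import Data.Integer as ℤ
import Data.Integer.Properties as ℤ
open import Data.List using ([]; _∷_; _++_; length; concatMap; upTo)
open import Data.List.Properties using (≡-dec; ++-identityʳ; upTo-∷ʳ; concatMap-++)
open import Data.Nat as ℕ using (ℕ; zero; suc; _∸_; _!; _≤_; _<_; z≤n; s≤s; NonZero)
open import Data.Nat.Combinatorics using (_C_; nCn≡1; nCk+nC[k+1]≡[n+1]C[k+1])
import Data.Nat.Properties as ℕ
import Data.Nat.Tactic.RingSolver as ℕ-Solver
open import Data.Product using (_,_)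
open import Data.Rational as ℚ using (ℚ; 0ℚ; 1ℚ; _+_; _*_; -_; toℚᵘ)
import Data.Rational.Properties as ℚ
open import Data.Rational.Solver using (module +-*-Solver)
open import Data.Rational.Unnormalised as ℚᵘ using (mkℚᵘ; *≡*) renaming (_+_ to _+ᵘ_; _*_ to _*ᵘ_)
import Data.Rational.Unnormalised.Properties as ℚᵘ
open import Data.Unit using (tt)
open import Function using (_∘_; case_of_)
open import Relation.Binary.PropositionalEquality
open import Relation.Nullary using (¬_; yes; no; Dec)
open import Relation.Nullary.Decidable using (⌊_⌋; map′)

open import Algebra.Definitions.RawSemiring ℚ.+-*-rawSemiring using (_^_)
open +-*-Solver using (_:+_; _:*_; :-_; _:=_; con)

toℚᵘ-fromℕ : ∀ n → toℚᵘ (fromℕ n) ℚᵘ.≃ mkℚᵘ (ℤ.+ n) 0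
toℚᵘ-fromℕ n = ℚ.toℚᵘ-fromℚᵘ (mkℚᵘ (ℤ.+ n) 0)

fromℕ-+ : ∀ m n → fromℕ (m ℕ.+ n) ≡ fromℕ m + fromℕ n
fromℕ-+ m n = ℚ.toℚᵘ-injective (begin
  toℚᵘ (fromℕ (m ℕ.+ n))            ≈⟨ toℚᵘ-fromℕ (m ℕ.+ n) ⟩
  mkℚᵘ (ℤ.+ (m ℕ.+ n)) 0            ≈⟨ *≡* (cong (ℤ._* ℤ.+ 1) +-homo) ⟩
  mkℚᵘ (ℤ.+ m) 0 +ᵘ mkℚᵘ (ℤ.+ n) 0  ≈⟨ ℚᵘ.+-cong (toℚᵘ-fromℕ m) (toℚᵘ-fromℕ n) ⟨
  toℚᵘ (fromℕ m) +ᵘ toℚᵘ (fromℕ n)  ≈⟨ ℚ.toℚᵘ-homo-+ (fromℕ m) (fromℕ n) ⟨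
  toℚᵘ (fromℕ m + fromℕ n)          ∎)
  where
  open ℚᵘ.≃-Reasoning
  +-homo : ℤ.+ (m ℕ.+ n) ≡ ℤ.+ m ℤ.* ℤ.+ 1 ℤ.+ ℤ.+ n ℤ.* ℤ.+ 1
  +-homo = trans (ℤ.pos-+ m n) (sym (cong₂ ℤ._+_ (ℤ.*-identityʳ (ℤ.+ m)) (ℤ.*-identityʳ (ℤ.+ n))))

fromℕ-* : ∀ m n → fromℕ (m ℕ.* n) ≡ fromℕ m * fromℕ n
fromℕ-* m n = ℚ.toℚᵘ-injective (begin
  toℚᵘ (fromℕ (m ℕ.* n))            ≈⟨ toℚᵘ-fromℕ (m ℕ.* n) ⟩
  mkℚᵘ (ℤ.+ (m ℕ.* n)) 0            ≈⟨ *≡* (cong (ℤ._* ℤ.+ 1) (ℤ.pos-* m n)) ⟩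
  mkℚᵘ (ℤ.+ m) 0 *ᵘ mkℚᵘ (ℤ.+ n) 0  ≈⟨ ℚᵘ.*-cong (toℚᵘ-fromℕ m) (toℚᵘ-fromℕ n) ⟨
  toℚᵘ (fromℕ m) *ᵘ toℚᵘ (fromℕ n)  ≈⟨ ℚ.toℚᵘ-homo-* (fromℕ m) (fromℕ n) ⟨
  toℚᵘ (fromℕ m * fromℕ n)          ∎)
  where open ℚᵘ.≃-Reasoning

fromℕ*invNat : ∀ n .{{_ : NonZero n}} → fromℕ n * invNat n ≡ 1ℚ
fromℕ*invNat (suc n) = ℚ.toℚᵘ-injective (begin
  toℚᵘ (fromℕ (suc n) * invNat (suc n))          ≈⟨ ℚ.toℚᵘ-homo-* (fromℕ (suc n)) (invNat (suc n)) ⟩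
  toℚᵘ (fromℕ (suc n)) *ᵘ toℚᵘ (invNat (suc n))  ≈⟨ ℚᵘ.*-cong (toℚᵘ-fromℕ (suc n)) (ℚ.toℚᵘ-fromℚᵘ (mkℚᵘ (ℤ.+ 1) n)) ⟩
  mkℚᵘ (ℤ.+ suc n) 0 *ᵘ ℚᵘ.1/ mkℚᵘ (ℤ.+ suc n) 0  ≈⟨ ℚᵘ.*-inverseʳ (mkℚᵘ (ℤ.+ suc n) 0) ⟩
  ℚᵘ.1ℚᵘ                                         ∎)
  where open ℚᵘ.≃-Reasoning

invNat-unique : ∀ n .{{_ : NonZero n}} {x} → fromℕ n * x ≡ 1ℚ → invNat n ≡ x
invNat-unique n {x} nx≡1 = begin
  invNat n                  ≡⟨ ℚ.*-identityʳ (invNat n) ⟨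
  invNat n * 1ℚ             ≡⟨ cong (invNat n *_) nx≡1 ⟨
  invNat n * (fromℕ n * x)  ≡⟨ ℚ.*-assoc (invNat n) (fromℕ n) x ⟨
  (invNat n * fromℕ n) * x  ≡⟨ cong (_* x) (trans (ℚ.*-comm (invNat n) (fromℕ n)) (fromℕ*invNat n)) ⟩
  1ℚ * x                    ≡⟨ ℚ.*-identityˡ x ⟩
  x                         ∎
  where open ≡-Reasoning

invNat-* : ∀ m n .{{_ : NonZero m}} .{{_ : NonZero n}} → invNat (m ℕ.* n) ≡ invNat m * invNat n
invNat-* m n = invNat-unique (m ℕ.* n) {{ℕ.m*n≢0 m n}} (begin
  fromℕ (m ℕ.* n) * (invNat m * invNat n)      ≡⟨ cong (_* (invNat m * invNat n)) (fromℕ-* m n) ⟩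
  (fromℕ m * fromℕ n) * (invNat m * invNat n)  ≡⟨ interchange (fromℕ m) (fromℕ n) (invNat m) (invNat n) ⟩
  (fromℕ m * invNat m) * (fromℕ n * invNat n)  ≡⟨ cong₂ _*_ (fromℕ*invNat m) (fromℕ*invNat n) ⟩
  1ℚ                                           ∎)
  where
  open ≡-Reasoning
  interchange : ∀ a b c d → (a * b) * (c * d) ≡ (a * c) * (b * d)
  interchange = +-*-Solver.solve 4 (λ a b c d → (a :* b) :* (c :* d) := (a :* c) :* (b :* d)) refl

infix 4 _≈ₘ_ _≈ₘ?_

_≈ₘ_ : Mono → Mono → Set
x ≈ₘ y = ∀ i → expAt i x ≡ expAt i y

≈ₘ-sym : ∀ {x y} → x ≈ₘ y → y ≈ₘ x
≈ₘ-sym x≈y i = sym (x≈y i)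

expAt-trim-∷ : ∀ i e m → expAt i (trim (e ∷ m)) ≡ expAt i (e ∷ trim m)
expAt-trim-∷ i e m with trim m
expAt-trim-∷ zero    zero    m | []    = refl
expAt-trim-∷ (suc i) zero    m | []    = refl
expAt-trim-∷ i       (suc e) m | []    = refl
expAt-trim-∷ i       zero    m | _ ∷ _ = refl
expAt-trim-∷ i       (suc e) m | _ ∷ _ = refl

expAt-trim : ∀ i m → expAt i (trim m) ≡ expAt i m
expAt-trim i       []      = refl
expAt-trim zero    (e ∷ m) = expAt-trim-∷ zero e m
expAt-trim (suc i) (e ∷ m) = trans (expAt-trim-∷ (suc i) e m) (expAt-trim i m)

trim-∷-cong : ∀ e x y → trim x ≡ trim y → trim (e ∷ x) ≡ trim (e ∷ y)
trim-∷-cong e x y eq with trim x | trim y | eq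
... | t | .t | refl = refl

≈ₘ⇒trim≡ : ∀ x y → x ≈ₘ y → trim x ≡ trim y
≈ₘ⇒trim≡ []      []      _   = refl
≈ₘ⇒trim≡ []      (f ∷ y) x≈y rewrite sym (x≈y 0) = trim-∷-cong 0 [] y (≈ₘ⇒trim≡ [] y (x≈y ∘ suc))
≈ₘ⇒trim≡ (e ∷ x) []      x≈y rewrite x≈y 0 = trim-∷-cong 0 x [] (≈ₘ⇒trim≡ x [] (x≈y ∘ suc))
≈ₘ⇒trim≡ (e ∷ x) (f ∷ y) x≈y rewrite x≈y 0 = trim-∷-cong f x y (≈ₘ⇒trim≡ x y (x≈y ∘ suc))

trim≡⇒≈ₘ : ∀ x y → trim x ≡ trim y → x ≈ₘ y
trim≡⇒≈ₘ x y eq i = trans (sym (expAt-trim i x)) (trans (cong (expAt i) eq) (expAt-trim i y))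

_≈ₘ?_ : ∀ x y → Dec (x ≈ₘ y)
x ≈ₘ? y = map′ (trim≡⇒≈ₘ x y) (≈ₘ⇒trim≡ x y) (≡-dec ℕ._≟_ (trim x) (trim y))

termCoeff : Mono → Mono → ℚ → ℚ
termCoeff m′ m c = if ⌊ ≡-dec ℕ._≟_ (trim m′) (trim m) ⌋ then c else 0ℚ

termCoeff-≈ₘ : ∀ m′ m c → m′ ≈ₘ m → termCoeff m′ m c ≡ c
termCoeff-≈ₘ m′ m c m′≈m with ≡-dec ℕ._≟_ (trim m′) (trim m)
... | yes _  = refl
... | no ≢  = ⊥-elim (≢ (≈ₘ⇒trim≡ m′ m m′≈m))

termCoeff-≉ₘ : ∀ m′ m c → ¬ m′ ≈ₘ m → termCoeff m′ m c ≡ 0ℚ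
termCoeff-≉ₘ m′ m c m′≉m with ≡-dec ℕ._≟_ (trim m′) (trim m)
... | yes eq = ⊥-elim (m′≉m (trim≡⇒≈ₘ m′ m eq))
... | no _   = refl

termCoeff-zero : ∀ m′ m → termCoeff m′ m 0ℚ ≡ 0ℚ
termCoeff-zero m′ m with ⌊ ≡-dec ℕ._≟_ (trim m′) (trim m) ⌋
... | true  = refl
... | false = refl

termCoeff-scale : ∀ m′ m c a → termCoeff m′ m (c * a) ≡ c * termCoeff m′ m a
termCoeff-scale m′ m c a with ⌊ ≡-dec ℕ._≟_ (trim m′) (trim m) ⌋
... | true  = refl
... | false = sym (ℚ.*-zeroʳ c)

termCoeff-transport : ∀ m₁ m₂ n₁ n₂ c → (m₁ ≈ₘ m₂ → n₁ ≈ₘ n₂) → (n₁ ≈ₘ n₂ → m₁ ≈ₘ m₂) →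
                      termCoeff m₁ m₂ c ≡ termCoeff n₁ n₂ c
termCoeff-transport m₁ m₂ n₁ n₂ c to from with n₁ ≈ₘ? n₂
... | yes n₁≈n₂ = trans (termCoeff-≈ₘ m₁ m₂ c (from n₁≈n₂)) (sym (termCoeff-≈ₘ n₁ n₂ c n₁≈n₂))
... | no  n₁≉n₂ = trans (termCoeff-≉ₘ m₁ m₂ c (n₁≉n₂ ∘ to)) (sym (termCoeff-≉ₘ n₁ n₂ c n₁≉n₂))

coeff-++ : ∀ p q m → coeff (p ++ q) m ≡ coeff p m + coeff q m
coeff-++ []             q m = sym (ℚ.+-identityˡ (coeff q m))
coeff-++ ((c , m′) ∷ p) q m = trans (cong (termCoeff m′ m c +_) (coeff-++ p q m))
                                    (sym (ℚ.+-assoc (termCoeff m′ m c) (coeff p m) (coeff q m)))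

coeff-scale : ∀ c p m → coeff (scale c p) m ≡ c * coeff p m
coeff-scale c []             m = sym (ℚ.*-zeroʳ c)
coeff-scale c ((a , m′) ∷ p) m = trans (cong₂ _+_ (termCoeff-scale m′ m c a) (coeff-scale c p m))
                                       (sym (ℚ.*-distribˡ-+ c (termCoeff m′ m a) (coeff p m)))

expAt-incAt-≡ : ∀ k m → expAt k (incAt k m) ≡ suc (expAt k m)
expAt-incAt-≡ zero    []      = refl
expAt-incAt-≡ zero    (e ∷ m) = refl
expAt-incAt-≡ (suc k) []      = expAt-incAt-≡ k []
expAt-incAt-≡ (suc k) (e ∷ m) = expAt-incAt-≡ k m

expAt-incAt-≢ : ∀ {i k} m → i ≢ k → expAt i (incAt k m) ≡ expAt i m
expAt-incAt-≢ {zero}  {zero}  m       i≢k = ⊥-elim (i≢k refl)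
expAt-incAt-≢ {zero}  {suc k} []      _   = refl
expAt-incAt-≢ {zero}  {suc k} (e ∷ m) _   = refl
expAt-incAt-≢ {suc i} {zero}  []      _   = refl
expAt-incAt-≢ {suc i} {zero}  (e ∷ m) _   = refl
expAt-incAt-≢ {suc i} {suc k} []      i≢k = expAt-incAt-≢ [] (i≢k ∘ cong suc)
expAt-incAt-≢ {suc i} {suc k} (e ∷ m) i≢k = expAt-incAt-≢ m (i≢k ∘ cong suc)

expAt-decAt-≡ : ∀ k m → expAt k (decAt k m) ≡ expAt k m ∸ 1
expAt-decAt-≡ k       []      = refl
expAt-decAt-≡ zero    (e ∷ m) = refl
expAt-decAt-≡ (suc k) (e ∷ m) = expAt-decAt-≡ k m

expAt-decAt-≢ : ∀ {i k} m → i ≢ k → expAt i (decAt k m) ≡ expAt i m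
expAt-decAt-≢ {i}     {k}     []      _   = refl
expAt-decAt-≢ {zero}  {zero}  (e ∷ m) i≢k = ⊥-elim (i≢k refl)
expAt-decAt-≢ {zero}  {suc k} (e ∷ m) _   = refl
expAt-decAt-≢ {suc i} {zero}  (e ∷ m) _   = refl
expAt-decAt-≢ {suc i} {suc k} (e ∷ m) i≢k = expAt-decAt-≢ m (i≢k ∘ cong suc)

incAt-≈ₘ⇒≈ₘ-decAt : ∀ k x m → incAt k x ≈ₘ m → x ≈ₘ decAt k m
incAt-≈ₘ⇒≈ₘ-decAt k x m x⁺≈m i with i ℕ.≟ k
... | yes refl = begin
  expAt k x                   ≡⟨⟩
  suc (expAt k x) ∸ 1         ≡⟨ cong (_∸ 1) (trans (sym (expAt-incAt-≡ k x)) (x⁺≈m k)) ⟩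
  expAt k m ∸ 1               ≡⟨ expAt-decAt-≡ k m ⟨
  expAt k (decAt k m)         ∎
  where open ≡-Reasoning
... | no i≢k = trans (sym (expAt-incAt-≢ x i≢k)) (trans (x⁺≈m i) (sym (expAt-decAt-≢ m i≢k)))

≈ₘ-decAt⇒incAt-≈ₘ : ∀ k x m {e} → expAt k m ≡ suc e → x ≈ₘ decAt k m → incAt k x ≈ₘ m
≈ₘ-decAt⇒incAt-≈ₘ k x m {e} mₖ≡1+e x≈m⁻ i with i ℕ.≟ k
... | yes refl = begin
  expAt k (incAt k x)         ≡⟨ expAt-incAt-≡ k x ⟩
  suc (expAt k x)             ≡⟨ cong suc (trans (x≈m⁻ k) (expAt-decAt-≡ k m)) ⟩
  suc (expAt k m ∸ 1)         ≡⟨ cong (λ n → suc (n ∸ 1)) mₖ≡1+e ⟩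
  suc e                       ≡⟨ mₖ≡1+e ⟨
  expAt k m                   ∎
  where open ≡-Reasoning
... | no i≢k = trans (expAt-incAt-≢ x i≢k) (trans (x≈m⁻ i) (expAt-decAt-≢ m i≢k))

coeff-hMinus-zero : ∀ k p m → expAt k m ≡ 0 → coeff (hMinus (suc k) p) m ≡ 0ℚ
coeff-hMinus-zero k []             m _    = refl
coeff-hMinus-zero k ((a , x) ∷ p) m mₖ≡0 =
  trans (cong₂ _+_ (termCoeff-≉ₘ (incAt k x) m a x⁺≉m) (coeff-hMinus-zero k p m mₖ≡0)) (ℚ.+-identityˡ 0ℚ)
  where
  x⁺≉m : ¬ incAt k x ≈ₘ m
  x⁺≉m x⁺≈m with trans (sym (expAt-incAt-≡ k x)) (trans (x⁺≈m k) mₖ≡0)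
  ... | ()

coeff-hMinus-suc : ∀ k p m {e} → expAt k m ≡ suc e → coeff (hMinus (suc k) p) m ≡ coeff p (decAt k m)
coeff-hMinus-suc k []             m _       = refl
coeff-hMinus-suc k ((a , x) ∷ p) m mₖ≡1+e =
  cong₂ _+_ (termCoeff-transport (incAt k x) m x (decAt k m) a
                                 (incAt-≈ₘ⇒≈ₘ-decAt k x m) (≈ₘ-decAt⇒incAt-≈ₘ k x m mₖ≡1+e))
            (coeff-hMinus-suc k p m mₖ≡1+e)

termCoeff-deriv : ∀ k x m a → termCoeff (decAt k x) m (a * fromℕ (expAt k x))
                            ≡ termCoeff x (incAt k m) a * fromℕ (suc (expAt k m))
termCoeff-deriv k x m a with x ≈ₘ? incAt k m
... | yes x≈m⁺ = begin
  termCoeff (decAt k x) m (a * fromℕ (expAt k x))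
    ≡⟨ termCoeff-≈ₘ (decAt k x) m _ (≈ₘ-sym {m} {decAt k x} (incAt-≈ₘ⇒≈ₘ-decAt k m x (≈ₘ-sym {x} {incAt k m} x≈m⁺))) ⟩
  a * fromℕ (expAt k x)
    ≡⟨ cong (λ n → a * fromℕ n) (trans (x≈m⁺ k) (expAt-incAt-≡ k m)) ⟩
  a * fromℕ (suc (expAt k m))
    ≡⟨ cong (_* fromℕ (suc (expAt k m))) (termCoeff-≈ₘ x (incAt k m) a x≈m⁺) ⟨
  termCoeff x (incAt k m) a * fromℕ (suc (expAt k m))
    ∎
  where open ≡-Reasoning
... | no x≉m⁺ = trans lhs≡0 (sym (trans (cong (_* fromℕ (suc (expAt k m))) (termCoeff-≉ₘ x (incAt k m) a x≉m⁺))
                                        (ℚ.*-zeroˡ (fromℕ (suc (expAt k m))))))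
  where
  -- Either the factor expAt k x vanishes, or decAt k x ≉ m.
  lhs≡0 : termCoeff (decAt k x) m (a * fromℕ (expAt k x)) ≡ 0ℚ
  lhs≡0 with expAt k x in xₖ≡
  ... | zero  = trans (cong (termCoeff (decAt k x) m) (ℚ.*-zeroʳ a)) (termCoeff-zero (decAt k x) m)
  ... | suc _ = termCoeff-≉ₘ (decAt k x) m _
                  (x≉m⁺ ∘ ≈ₘ-sym {incAt k m} {x} ∘ ≈ₘ-decAt⇒incAt-≈ₘ k m x xₖ≡ ∘ ≈ₘ-sym {decAt k x} {m})

coeff-deriv : ∀ k p m → coeff (deriv k p) m ≡ coeff p (incAt k m) * fromℕ (suc (expAt k m))
coeff-deriv k []             m = sym (ℚ.*-zeroˡ (fromℕ (suc (expAt k m))))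
coeff-deriv k ((a , x) ∷ p) m =
  trans (cong₂ _+_ (termCoeff-deriv k x m a) (coeff-deriv k p m))
        (sym (ℚ.*-distribʳ-+ (fromℕ (suc (expAt k m))) (termCoeff x (incAt k m) a) (coeff p (incAt k m))))

coeff-hPlus : ∀ k p m → coeff (hPlus (suc k) p) m ≡ fromℕ (suc k) * (coeff p (incAt k m) * fromℕ (suc (expAt k m)))
coeff-hPlus k p m = trans (coeff-scale (fromℕ (suc k)) (deriv k p) m) (cong (fromℕ (suc k) *_) (coeff-deriv k p m))

expAt-≥length : ∀ n x → length x ≤ n → expAt n x ≡ 0
expAt-≥length n       []      _         = refl
expAt-≥length (suc n) (e ∷ x) (s≤s x≤n) = expAt-≥length n x x≤n

coeff-deriv-≥varBound : ∀ n p m → varBound p ≤ n → coeff (deriv n p) m ≡ 0ℚ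
coeff-deriv-≥varBound n []             m _ = refl
coeff-deriv-≥varBound n ((a , x) ∷ p) m p≤n = begin
  termCoeff (decAt n x) m (a * fromℕ (expAt n x)) + coeff (deriv n p) m
    ≡⟨ cong₂ (λ e q → termCoeff (decAt n x) m (a * fromℕ e) + q)
             (expAt-≥length n x (ℕ.m⊔n≤o⇒m≤o (length x) (varBound p) p≤n))
             (coeff-deriv-≥varBound n p m (ℕ.m⊔n≤o⇒n≤o (length x) (varBound p) p≤n)) ⟩
  termCoeff (decAt n x) m (a * 0ℚ) + 0ℚ
    ≡⟨ cong (_+ 0ℚ) (trans (cong (termCoeff (decAt n x) m) (ℚ.*-zeroʳ a)) (termCoeff-zero (decAt n x) m)) ⟩
  0ℚ
    ∎
  where open ≡-Reasoning

coeff-concatMap-upTo : ∀ (g : ℕ → Poly) n m → coeff (concatMap g (upTo (suc n))) m ≡ sumTo (λ i → coeff (g i) m) n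
coeff-concatMap-upTo g zero    m = trans (coeff-++ (g 0) [] m) (ℚ.+-identityʳ (coeff (g 0) m))
coeff-concatMap-upTo g (suc n) m = begin
  coeff (concatMap g (upTo (suc (suc n)))) m
    ≡⟨ cong (λ xs → coeff (concatMap g xs) m) (upTo-∷ʳ (suc n)) ⟨
  coeff (concatMap g (upTo (suc n) ++ suc n ∷ [])) m
    ≡⟨ cong (λ p → coeff p m) (concatMap-++ g (upTo (suc n)) (suc n ∷ [])) ⟩
  coeff (concatMap g (upTo (suc n)) ++ (g (suc n) ++ [])) m
    ≡⟨ coeff-++ (concatMap g (upTo (suc n))) (g (suc n) ++ []) m ⟩
  coeff (concatMap g (upTo (suc n))) m + coeff (g (suc n) ++ []) m
    ≡⟨ cong₂ _+_ (coeff-concatMap-upTo g n m) (cong (λ p → coeff p m) (++-identityʳ (g (suc n)))) ⟩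
  sumTo (λ i → coeff (g i) m) n + coeff (g (suc n)) m
    ∎
  where open ≡-Reasoning

sumTo-cong : ∀ {f g} n → (∀ i → f i ≡ g i) → sumTo f n ≡ sumTo g n
sumTo-cong zero    f≗g = f≗g 0
sumTo-cong (suc n) f≗g = cong₂ _+_ (sumTo-cong n f≗g) (f≗g (suc n))

sumTo-*ʳ : ∀ f c n → sumTo (λ i → f i * c) n ≡ sumTo f n * c
sumTo-*ʳ f c zero    = refl
sumTo-*ʳ f c (suc n) = trans (cong (_+ f (suc n) * c) (sumTo-*ʳ f c n))
                             (sym (ℚ.*-distribʳ-+ c (sumTo f n) (f (suc n))))

sumTo-zero : ∀ f n → (∀ i → i ≤ n → f i ≡ 0ℚ) → sumTo f n ≡ 0ℚ
sumTo-zero f zero    f≡0 = f≡0 0 z≤n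
sumTo-zero f (suc n) f≡0 = trans (cong₂ _+_ (sumTo-zero f n (λ i i≤n → f≡0 i (ℕ.m≤n⇒m≤1+n i≤n)))
                                            (f≡0 (suc n) ℕ.≤-refl))
                                 (ℚ.+-identityʳ 0ℚ)

sumTo-single : ∀ f n i₀ → (∀ i → i ≤ n → i ≢ i₀ → f i ≡ 0ℚ) → (n < i₀ → f i₀ ≡ 0ℚ) → sumTo f n ≡ f i₀
sumTo-single f zero    zero     _      _      = refl
sumTo-single f zero    (suc i₀) others beyond = trans (others 0 z≤n (λ ())) (sym (beyond (s≤s z≤n)))
sumTo-single f (suc n) i₀       others beyond with suc n ℕ.≟ i₀
... | yes refl = trans (cong (_+ f (suc n)) (sumTo-zero f n (λ i i≤n → others i (ℕ.m≤n⇒m≤1+n i≤n) (ℕ.<⇒≢ (s≤s i≤n)))))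
                       (ℚ.+-identityˡ (f (suc n)))
... | no  1+n≢i₀ = trans (cong₂ _+_ (sumTo-single f n i₀ (λ i i≤n → others i (ℕ.m≤n⇒m≤1+n i≤n))
                                                     (λ n<i₀ → beyond (ℕ.≤∧≢⇒< n<i₀ 1+n≢i₀)))
                                    (others (suc n) ℕ.≤-refl 1+n≢i₀))
                         (ℚ.+-identityʳ (f i₀))

sumTo-first-two : ∀ f n → (∀ i → f (suc (suc i)) ≡ 0ℚ) → sumTo f (suc n) ≡ f 0 + f 1
sumTo-first-two f zero    _   = refl
sumTo-first-two f (suc n) f≡0 = trans (cong₂ _+_ (sumTo-first-two f n f≡0) (f≡0 n)) (ℚ.+-identityʳ (f 0 + f 1))

-- The subspace ℚ[h(-1), h(-2)]

anyPositive : Mono → Bool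
anyPositive []          = false
anyPositive (zero ∷ m)  = anyPositive m
anyPositive (suc _ ∷ _) = true

-- Does the monomial involve some h(-n) with n ≥ 3?
involvesHigher : Mono → Bool
involvesHigher (_ ∷ _ ∷ m) = anyPositive m
involvesHigher _           = false

[]≈ₘ⇒¬anyPositive : ∀ m → [] ≈ₘ m → anyPositive m ≡ false
[]≈ₘ⇒¬anyPositive []          _    = refl
[]≈ₘ⇒¬anyPositive (zero ∷ m)  []≈m = []≈ₘ⇒¬anyPositive m ([]≈m ∘ suc)
[]≈ₘ⇒¬anyPositive (suc _ ∷ m) []≈m with []≈m 0
... | ()

¬anyPositive⇒[]≈ₘ : ∀ m → anyPositive m ≡ false → [] ≈ₘ m
¬anyPositive⇒[]≈ₘ []         _  i       = refl
¬anyPositive⇒[]≈ₘ (zero ∷ m) _  zero    = refl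
¬anyPositive⇒[]≈ₘ (zero ∷ m) ¬p (suc i) = ¬anyPositive⇒[]≈ₘ m ¬p i

anyPositive-incAt : ∀ k m → anyPositive (incAt k m) ≡ true
anyPositive-incAt zero    []          = refl
anyPositive-incAt zero    (_ ∷ _)     = refl
anyPositive-incAt (suc k) []          = anyPositive-incAt k []
anyPositive-incAt (suc k) (zero ∷ m)  = anyPositive-incAt k m
anyPositive-incAt (suc k) (suc _ ∷ _) = refl

-- F a b is the coefficient of h(-1)ᵃ h(-2)ᵇ.
Coeffs₂ : Set
Coeffs₂ = ℕ → ℕ → ℚ

coeff₂ : Coeffs₂ → Mono → ℚ
coeff₂ F m = if involvesHigher m then 0ℚ else F (expAt 0 m) (expAt 1 m)

infix 4 _≈₂_ _≗₂_

record _≈₂_ (p : Poly) (F : Coeffs₂) : Set where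
  field coeff≡ : ∀ m → coeff p m ≡ coeff₂ F m
open _≈₂_ public

_≗₂_ : Coeffs₂ → Coeffs₂ → Set
F ≗₂ G = ∀ a b → F a b ≡ G a b

infixl 6 _⊕_
infixl 7 _⊙_

_⊕_ : Coeffs₂ → Coeffs₂ → Coeffs₂
(F ⊕ G) a b = F a b + G a b

_⊙_ : ℚ → Coeffs₂ → Coeffs₂
(c ⊙ F) a b = c * F a b

mulX : Coeffs₂ → Coeffs₂
mulX F zero    b = 0ℚ
mulX F (suc a) b = F a b

mulY : Coeffs₂ → Coeffs₂
mulY F a zero    = 0ℚ
mulY F a (suc b) = F a b

∂Y : Coeffs₂ → Coeffs₂
∂Y F a b = F a (suc b) * fromℕ (suc b)

coeff₂-≡0 : ∀ F m → F (expAt 0 m) (expAt 1 m) ≡ 0ℚ → coeff₂ F m ≡ 0ℚ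
coeff₂-≡0 F m F≡0 with involvesHigher m
... | true  = refl
... | false = F≡0

coeff₂-cong : ∀ {F G} → F ≗₂ G → ∀ m → coeff₂ F m ≡ coeff₂ G m
coeff₂-cong F≗G m with involvesHigher m
... | true  = refl
... | false = F≗G (expAt 0 m) (expAt 1 m)

coeff₂-⊕ : ∀ F G m → coeff₂ (F ⊕ G) m ≡ coeff₂ F m + coeff₂ G m
coeff₂-⊕ F G m with involvesHigher m
... | true  = refl
... | false = refl

coeff₂-⊙ : ∀ c F m → coeff₂ (c ⊙ F) m ≡ c * coeff₂ F m
coeff₂-⊙ c F m with involvesHigher m
... | true  = sym (ℚ.*-zeroʳ c)
... | false = refl

coeff₂-sumTo : ∀ (G : ℕ → Coeffs₂) n m →
               coeff₂ (λ a b → sumTo (λ l → G l a b) n) m ≡ sumTo (λ l → coeff₂ (G l) m) n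
coeff₂-sumTo G n m with involvesHigher m
... | true  = sym (sumTo-zero (λ _ → 0ℚ) n (λ _ _ → refl))
... | false = refl

≈₂-cong : ∀ {p F G} → p ≈₂ F → F ≗₂ G → p ≈₂ G
≈₂-cong p≈F F≗G .coeff≡ m = trans (p≈F .coeff≡ m) (coeff₂-cong F≗G m)

++-≈₂ : ∀ {p q F G} → p ≈₂ F → q ≈₂ G → p ++ q ≈₂ F ⊕ G
++-≈₂ {p} {q} {F} {G} p≈F q≈G .coeff≡ m =
  trans (coeff-++ p q m) (trans (cong₂ _+_ (p≈F .coeff≡ m) (q≈G .coeff≡ m)) (sym (coeff₂-⊕ F G m)))

scale-≈₂ : ∀ {p F} c → p ≈₂ F → scale c p ≈₂ c ⊙ F
scale-≈₂ {p} {F} c p≈F .coeff≡ m =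
  trans (coeff-scale c p m) (trans (cong (c *_) (p≈F .coeff≡ m)) (sym (coeff₂-⊙ c F m)))

concatMap-scale-≈₂ : ∀ (c : ℕ → ℚ) (ps : ℕ → Poly) (Fs : ℕ → Coeffs₂) n → (∀ l → ps l ≈₂ Fs l) →
                     concatMap (λ l → scale (c l) (ps l)) (upTo (suc n)) ≈₂ (λ a b → sumTo (λ l → c l * Fs l a b) n)
concatMap-scale-≈₂ c ps Fs n ps≈Fs .coeff≡ m = begin
  coeff (concatMap (λ l → scale (c l) (ps l)) (upTo (suc n))) m
    ≡⟨ coeff-concatMap-upTo (λ l → scale (c l) (ps l)) n m ⟩
  sumTo (λ l → coeff (scale (c l) (ps l)) m) n
    ≡⟨ sumTo-cong n (λ l → scale-≈₂ (c l) (ps≈Fs l) .coeff≡ m) ⟩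
  sumTo (λ l → coeff₂ (c l ⊙ Fs l) m) n
    ≡⟨ coeff₂-sumTo (λ l → c l ⊙ Fs l) n m ⟨
  coeff₂ (λ a b → sumTo (λ l → c l * Fs l a b) n) m
    ∎
  where open ≡-Reasoning

coeff₂-decAt-0 : ∀ F m {e} → expAt 0 m ≡ suc e → coeff₂ F (decAt 0 m) ≡ coeff₂ (mulX F) m
coeff₂-decAt-0 F (_ ∷ [])    refl = refl
coeff₂-decAt-0 F (_ ∷ _ ∷ _) refl = refl

coeff₂-decAt-1 : ∀ F m {e} → expAt 1 m ≡ suc e → coeff₂ F (decAt 1 m) ≡ coeff₂ (mulY F) m
coeff₂-decAt-1 F (_ ∷ _ ∷ _) refl = refl

coeff₂-incAt-1 : ∀ F m → coeff₂ F (incAt 1 m) * fromℕ (suc (expAt 1 m)) ≡ coeff₂ (∂Y F) m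
coeff₂-incAt-1 F []          = refl
coeff₂-incAt-1 F (_ ∷ [])    = refl
coeff₂-incAt-1 F (_ ∷ b ∷ m) with anyPositive m
... | true  = ℚ.*-zeroˡ (fromℕ (suc b))
... | false = refl

coeff₂-incAt-≥2 : ∀ F k m → coeff₂ F (incAt (suc (suc k)) m) ≡ 0ℚ
coeff₂-incAt-≥2 F k []          rewrite anyPositive-incAt k [] = refl
coeff₂-incAt-≥2 F k (_ ∷ [])    rewrite anyPositive-incAt k [] = refl
coeff₂-incAt-≥2 F k (_ ∷ _ ∷ m) rewrite anyPositive-incAt k m  = refl

hMinus1-≈₂ : ∀ {p F} → p ≈₂ F → hMinus 1 p ≈₂ mulX F
hMinus1-≈₂ {p} {F} p≈F .coeff≡ m = byExponent (expAt 0 m) refl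
  where
  byExponent : ∀ e → expAt 0 m ≡ e → coeff (hMinus 1 p) m ≡ coeff₂ (mulX F) m
  byExponent zero    m₀≡0 = trans (coeff-hMinus-zero 0 p m m₀≡0)
                                  (sym (coeff₂-≡0 (mulX F) m (cong (λ a → mulX F a (expAt 1 m)) m₀≡0)))
  byExponent (suc _) m₀≡  = trans (coeff-hMinus-suc 0 p m m₀≡)
                                  (trans (p≈F .coeff≡ (decAt 0 m)) (coeff₂-decAt-0 F m m₀≡))

hMinus2-≈₂ : ∀ {p F} → p ≈₂ F → hMinus 2 p ≈₂ mulY F
hMinus2-≈₂ {p} {F} p≈F .coeff≡ m = byExponent (expAt 1 m) refl
  where
  byExponent : ∀ e → expAt 1 m ≡ e → coeff (hMinus 2 p) m ≡ coeff₂ (mulY F) m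
  byExponent zero    m₁≡0 = trans (coeff-hMinus-zero 1 p m m₁≡0)
                                  (sym (coeff₂-≡0 (mulY F) m (cong (mulY F (expAt 0 m)) m₁≡0)))
  byExponent (suc _) m₁≡  = trans (coeff-hMinus-suc 1 p m m₁≡)
                                  (trans (p≈F .coeff≡ (decAt 1 m)) (coeff₂-decAt-1 F m m₁≡))

hPlus2-≈₂ : ∀ {p F} → p ≈₂ F → hPlus 2 p ≈₂ fromℕ 2 ⊙ ∂Y F
hPlus2-≈₂ {p} {F} p≈F .coeff≡ m = begin
  coeff (hPlus 2 p) m                         ≡⟨ coeff-hPlus 1 p m ⟩
  fromℕ 2 * (coeff p (incAt 1 m) * e)         ≡⟨ cong (λ x → fromℕ 2 * (x * e)) (p≈F .coeff≡ (incAt 1 m)) ⟩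
  fromℕ 2 * (coeff₂ F (incAt 1 m) * e)        ≡⟨ cong (fromℕ 2 *_) (coeff₂-incAt-1 F m) ⟩
  fromℕ 2 * coeff₂ (∂Y F) m                   ≡⟨ coeff₂-⊙ (fromℕ 2) (∂Y F) m ⟨
  coeff₂ (fromℕ 2 ⊙ ∂Y F) m                   ∎
  where
  open ≡-Reasoning
  e = fromℕ (suc (expAt 1 m))

coeff-hPlus-≥3 : ∀ {p F} → p ≈₂ F → ∀ k m → coeff (hPlus (3 ℕ.+ k) p) m ≡ 0ℚ
coeff-hPlus-≥3 {p} {F} p≈F k m = begin
  coeff (hPlus (3 ℕ.+ k) p) m                  ≡⟨ coeff-hPlus (2 ℕ.+ k) p m ⟩
  fromℕ (3 ℕ.+ k) * (coeff p m⁺ * e)           ≡⟨ cong (λ x → fromℕ (3 ℕ.+ k) * (x * e))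
                                                       (trans (p≈F .coeff≡ m⁺) (coeff₂-incAt-≥2 F k m)) ⟩
  fromℕ (3 ℕ.+ k) * (0ℚ * e)                   ≡⟨ cong (fromℕ (3 ℕ.+ k) *_) (ℚ.*-zeroˡ e) ⟩
  fromℕ (3 ℕ.+ k) * 0ℚ                         ≡⟨ ℚ.*-zeroʳ (fromℕ (3 ℕ.+ k)) ⟩
  0ℚ                                           ∎
  where
  open ≡-Reasoning
  m⁺ = incAt (2 ℕ.+ k) m
  e  = fromℕ (suc (expAt (2 ℕ.+ k) m))

-- h[-2] contains -1/240 h(2), and h(2) = 2 ∂/∂h(-2).
κ : ℚ
κ = - invNat 120

fromℕ2*cPos2≡κ : fromℕ 2 * cPos 2 ≡ κ
fromℕ2*cPos2≡κ = refl

powS-expm1S-order : ∀ n i → i < n → powS expm1S n i ≡ 0ℚ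
powS-expm1S-order (suc n) zero    _         = ℚ.*-zeroˡ (powS expm1S n 0)
powS-expm1S-order (suc n) (suc i) (s≤s i<n) = sumTo-zero _ (suc i) term
  where
  term : ∀ j → j ≤ suc i → expm1S j * powS expm1S n (suc i ∸ j) ≡ 0ℚ
  term zero    _         = ℚ.*-zeroˡ (powS expm1S n (suc i))
  term (suc j) (s≤s j≤i) =
    trans (cong (expm1S (suc j) *_) (powS-expm1S-order n (i ∸ j) (ℕ.≤-<-trans (ℕ.m∸n≤m i j) i<n)))
          (ℚ.*-zeroʳ (expm1S (suc j)))

cNeg-≥2 : ∀ k → cNeg (2 ℕ.+ k) ≡ 0ℚ
cNeg-≥2 k = begin
  P 0 * expS 1 + P 1 * expS 0   ≡⟨ cong₂ (λ x y → x * expS 1 + y * expS 0)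
                                         (powS-expm1S-order (2 ℕ.+ k) 0 (s≤s z≤n))
                                         (powS-expm1S-order (2 ℕ.+ k) 1 (s≤s (s≤s z≤n))) ⟩
  0ℚ * expS 1 + 0ℚ * expS 0     ≡⟨⟩
  0ℚ                            ∎
  where
  open ≡-Reasoning
  P = powS expm1S (2 ℕ.+ k)

-- hBr2 p unfolds to creationTerms p (2 + varBound p) ++ annihilationTerms p (varBound p).
creationTerms : Poly → ℕ → Poly
creationTerms p n = concatMap (λ k → scale (cNeg k) (hMinus (suc k) p)) (upTo n)

annihilationTerms : Poly → ℕ → Poly
annihilationTerms p n = concatMap (λ k → scale (cPos (suc k)) (hPlus (suc k) p)) (upTo n)

creationTerms-≈₂ : ∀ {p F} → p ≈₂ F → ∀ n → creationTerms p (2 ℕ.+ n) ≈₂ mulX F ⊕ mulY F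
creationTerms-≈₂ {p} {F} p≈F n .coeff≡ m = begin
  coeff (creationTerms p (2 ℕ.+ n)) m          ≡⟨ coeff-concatMap-upTo term (suc n) m ⟩
  sumTo (λ k → coeff (term k) m) (suc n)       ≡⟨ sumTo-first-two (λ k → coeff (term k) m) n higher≡0 ⟩
  coeff (term 0) m + coeff (term 1) m          ≡⟨ cong₂ _+_ (unit-coefficient 1) (unit-coefficient 2) ⟩
  coeff (hMinus 1 p) m + coeff (hMinus 2 p) m  ≡⟨ cong₂ _+_ (hMinus1-≈₂ p≈F .coeff≡ m) (hMinus2-≈₂ p≈F .coeff≡ m) ⟩
  coeff₂ (mulX F) m + coeff₂ (mulY F) m        ≡⟨ coeff₂-⊕ (mulX F) (mulY F) m ⟨
  coeff₂ (mulX F ⊕ mulY F) m                   ∎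
  where
  open ≡-Reasoning
  term : ℕ → Poly
  term k = scale (cNeg k) (hMinus (suc k) p)
  -- cNeg 0 and cNeg 1 compute to 1.
  unit-coefficient : ∀ k → coeff (scale 1ℚ (hMinus k p)) m ≡ coeff (hMinus k p) m
  unit-coefficient k = trans (coeff-scale 1ℚ (hMinus k p) m) (ℚ.*-identityˡ (coeff (hMinus k p) m))
  higher≡0 : ∀ k → coeff (term (2 ℕ.+ k)) m ≡ 0ℚ
  higher≡0 k = trans (coeff-scale (cNeg (2 ℕ.+ k)) h m) (trans (cong (_* coeff h m) (cNeg-≥2 k)) (ℚ.*-zeroˡ (coeff h m)))
    where h = hMinus (3 ℕ.+ k) p

annihilationTerms-≈₂ : ∀ {p F} → p ≈₂ F → annihilationTerms p (varBound p) ≈₂ κ ⊙ ∂Y F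
annihilationTerms-≈₂ {p} {F} p≈F .coeff≡ m = byBound (varBound p) refl
  where
  open ≡-Reasoning
  term : ℕ → Poly
  term k = scale (cPos (suc k)) (hPlus (suc k) p)

  -- cPos 1 computes to 0.
  term0≡0 : coeff (term 0) m ≡ 0ℚ
  term0≡0 = trans (coeff-scale (cPos 1) (hPlus 1 p) m) (ℚ.*-zeroˡ (coeff (hPlus 1 p) m))

  term≥2≡0 : ∀ k → coeff (term (2 ℕ.+ k)) m ≡ 0ℚ
  term≥2≡0 k = trans (coeff-scale (cPos (3 ℕ.+ k)) (hPlus (3 ℕ.+ k) p) m)
                     (trans (cong (cPos (3 ℕ.+ k) *_) (coeff-hPlus-≥3 p≈F k m)) (ℚ.*-zeroʳ (cPos (3 ℕ.+ k))))

  term1 : coeff (term 1) m ≡ coeff₂ (κ ⊙ ∂Y F) m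
  term1 = begin
    coeff (term 1) m                   ≡⟨ coeff-scale (cPos 2) (hPlus 2 p) m ⟩
    cPos 2 * coeff (hPlus 2 p) m       ≡⟨ cong (cPos 2 *_) (trans (hPlus2-≈₂ p≈F .coeff≡ m) (coeff₂-⊙ (fromℕ 2) (∂Y F) m)) ⟩
    cPos 2 * (fromℕ 2 * ∂F)            ≡⟨ ℚ.*-assoc (cPos 2) (fromℕ 2) ∂F ⟨
    (cPos 2 * fromℕ 2) * ∂F            ≡⟨ cong (_* ∂F) (trans (ℚ.*-comm (cPos 2) (fromℕ 2)) fromℕ2*cPos2≡κ) ⟩
    κ * ∂F                             ≡⟨ coeff₂-⊙ κ (∂Y F) m ⟨
    coeff₂ (κ ⊙ ∂Y F) m                ∎
    where ∂F = coeff₂ (∂Y F) m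

  term1≡0 : varBound p ≤ 1 → coeff (term 1) m ≡ 0ℚ
  term1≡0 p≤1 = begin
    coeff (term 1) m                          ≡⟨ coeff-scale (cPos 2) (hPlus 2 p) m ⟩
    cPos 2 * coeff (hPlus 2 p) m              ≡⟨ cong (cPos 2 *_) (coeff-scale (fromℕ 2) (deriv 1 p) m) ⟩
    cPos 2 * (fromℕ 2 * coeff (deriv 1 p) m)  ≡⟨ cong (λ x → cPos 2 * (fromℕ 2 * x))
                                                      (coeff-deriv-≥varBound 1 p m p≤1) ⟩
    cPos 2 * (fromℕ 2 * 0ℚ)                   ≡⟨⟩
    0ℚ                                        ∎

  others≡0 : ∀ k → k ≢ 1 → coeff (term k) m ≡ 0ℚ
  others≡0 zero          _   = term0≡0
  others≡0 (suc zero)    k≢1 = ⊥-elim (k≢1 refl)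
  others≡0 (suc (suc k)) _   = term≥2≡0 k

  byBound : ∀ L → varBound p ≡ L → coeff (annihilationTerms p L) m ≡ coeff₂ (κ ⊙ ∂Y F) m
  byBound zero    p≡0   = trans (sym (term1≡0 (subst (_≤ 1) (sym p≡0) z≤n))) term1
  byBound (suc n) p≡1+n = begin
    coeff (annihilationTerms p (suc n)) m     ≡⟨ coeff-concatMap-upTo term n m ⟩
    sumTo (λ k → coeff (term k) m) n          ≡⟨ sumTo-single (λ k → coeff (term k) m) n 1 (λ k _ → others≡0 k)
                                                   (λ { (s≤s z≤n) → term1≡0 (ℕ.≤-reflexive p≡1+n) }) ⟩
    coeff (term 1) m                          ≡⟨ term1 ⟩
    coeff₂ (κ ⊙ ∂Y F) m                       ∎

raise : ℚ → Coeffs₂ → Coeffs₂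
raise c F = mulX F ⊕ mulY F ⊕ c ⊙ ∂Y F

hBr2-≈₂ : ∀ {p F} → p ≈₂ F → hBr2 p ≈₂ raise κ F
hBr2-≈₂ {p} p≈F = ++-≈₂ (creationTerms-≈₂ p≈F (varBound p)) (annihilationTerms-≈₂ p≈F)

hSum-≈₂ : ∀ {p F} → p ≈₂ F → hSum p ≈₂ mulY F ⊕ mulX F
hSum-≈₂ p≈F = ++-≈₂ (hMinus2-≈₂ p≈F) (hMinus1-≈₂ p≈F)

-- Polynomials in u = h(-1) + h(-2)

pascal : ℕ → ℕ → ℕ
pascal zero    b       = 1
pascal (suc a) zero    = 1
pascal (suc a) (suc b) = pascal a (suc b) ℕ.+ pascal (suc a) b

pascal-zeroʳ : ∀ a → pascal a 0 ≡ 1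
pascal-zeroʳ zero    = refl
pascal-zeroʳ (suc a) = refl

pascal-sym : ∀ a b → pascal a b ≡ pascal b a
pascal-sym zero    zero    = refl
pascal-sym zero    (suc b) = refl
pascal-sym (suc a) zero    = refl
pascal-sym (suc a) (suc b) = trans (cong₂ ℕ._+_ (pascal-sym a (suc b)) (pascal-sym (suc a) b))
                                   (ℕ.+-comm (pascal (suc b) a) (pascal b (suc a)))

pascal≡C : ∀ a b → pascal a b ≡ (a ℕ.+ b) C b
pascal≡C zero    b       = sym (nCn≡1 b)
pascal≡C (suc a) zero    = refl
pascal≡C (suc a) (suc b) = begin
  pascal a (suc b) ℕ.+ pascal (suc a) b            ≡⟨ cong₂ ℕ._+_ (pascal≡C a (suc b)) (pascal≡C (suc a) b) ⟩
  (a ℕ.+ suc b) C suc b ℕ.+ suc (a ℕ.+ b) C b      ≡⟨ cong (λ n → n C suc b ℕ.+ suc (a ℕ.+ b) C b) (ℕ.+-suc a b) ⟩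
  suc (a ℕ.+ b) C suc b ℕ.+ suc (a ℕ.+ b) C b      ≡⟨ ℕ.+-comm (suc (a ℕ.+ b) C suc b) (suc (a ℕ.+ b) C b) ⟩
  suc (a ℕ.+ b) C b ℕ.+ suc (a ℕ.+ b) C suc b      ≡⟨ nCk+nC[k+1]≡[n+1]C[k+1] (suc (a ℕ.+ b)) b ⟩
  suc (suc (a ℕ.+ b)) C suc b                      ≡⟨ cong (λ n → suc n C suc b) (ℕ.+-suc a b) ⟨
  suc (a ℕ.+ suc b) C suc b                        ∎
  where open ≡-Reasoning

pascal-1ˡ : ∀ k → pascal 1 k ≡ suc k
pascal-1ˡ zero    = refl
pascal-1ˡ (suc k) = cong suc (pascal-1ˡ k)

pascal-absorbʳ : ∀ a b → pascal a (suc b) ℕ.* suc b ≡ pascal a b ℕ.* suc (a ℕ.+ b)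
pascal-absorbʳ zero    b       = refl
pascal-absorbʳ (suc a) zero    = begin
  (pascal a 1 ℕ.+ 1) ℕ.* 1    ≡⟨ cong (λ n → (n ℕ.+ 1) ℕ.* 1) (trans (pascal-sym a 1) (pascal-1ˡ a)) ⟩
  (suc a ℕ.+ 1) ℕ.* 1         ≡⟨ arith a ⟩
  1 ℕ.* suc (suc a ℕ.+ 0)     ∎
  where
  open ≡-Reasoning
  arith : ∀ a → (suc a ℕ.+ 1) ℕ.* 1 ≡ 1 ℕ.* suc (suc a ℕ.+ 0)
  arith = ℕ-Solver.solve-∀
pascal-absorbʳ (suc a) (suc b) = begin
  (x ℕ.+ y) ℕ.* suc (suc b)
    ≡⟨ distrib x y b ⟩
  x ℕ.* suc (suc b) ℕ.+ (y ℕ.+ y ℕ.* suc b)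
    ≡⟨ cong₂ (λ s t → s ℕ.+ (y ℕ.+ t)) (pascal-absorbʳ a (suc b)) (pascal-absorbʳ (suc a) b) ⟩
  u ℕ.* suc (a ℕ.+ suc b) ℕ.+ (y ℕ.+ v ℕ.* suc (suc (a ℕ.+ b)))
    ≡⟨ cong (λ n → u ℕ.* suc n ℕ.+ (y ℕ.+ v ℕ.* suc (suc (a ℕ.+ b)))) (ℕ.+-suc a b) ⟩
  u ℕ.* suc (suc (a ℕ.+ b)) ℕ.+ ((u ℕ.+ v) ℕ.+ v ℕ.* suc (suc (a ℕ.+ b)))
    ≡⟨ collect u v (a ℕ.+ b) ⟩
  (u ℕ.+ v) ℕ.* suc (suc (suc (a ℕ.+ b)))
    ≡⟨ cong (λ n → (u ℕ.+ v) ℕ.* suc (suc n)) (ℕ.+-suc a b) ⟨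
  (u ℕ.+ v) ℕ.* suc (suc a ℕ.+ suc b)
    ∎
  where
  open ≡-Reasoning
  x = pascal a (suc (suc b))
  y = pascal (suc a) (suc b)
  u = pascal a (suc b)
  v = pascal (suc a) b
  distrib : ∀ x y b → (x ℕ.+ y) ℕ.* suc (suc b) ≡ x ℕ.* suc (suc b) ℕ.+ (y ℕ.+ y ℕ.* suc b)
  distrib = ℕ-Solver.solve-∀
  collect : ∀ u v n → u ℕ.* suc (suc n) ℕ.+ ((u ℕ.+ v) ℕ.+ v ℕ.* suc (suc n)) ≡ (u ℕ.+ v) ℕ.* suc (suc (suc n))
  collect = ℕ-Solver.solve-∀

pascal-absorbˡ : ∀ a b → pascal (suc a) b ℕ.* suc a ≡ pascal a b ℕ.* suc (a ℕ.+ b)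
pascal-absorbˡ a b = begin
  pascal (suc a) b ℕ.* suc a        ≡⟨ cong (ℕ._* suc a) (pascal-sym (suc a) b) ⟩
  pascal b (suc a) ℕ.* suc a        ≡⟨ pascal-absorbʳ b a ⟩
  pascal b a ℕ.* suc (b ℕ.+ a)      ≡⟨ cong₂ (λ x n → x ℕ.* suc n) (pascal-sym b a) (ℕ.+-comm b a) ⟩
  pascal a b ℕ.* suc (a ℕ.+ b)      ∎
  where open ≡-Reasoning

mulU : (ℕ → ℚ) → ℕ → ℚ
mulU k zero    = 0ℚ
mulU k (suc j) = k j

∂U : (ℕ → ℚ) → ℕ → ℚ
∂U k j = k (suc j) * fromℕ (suc j)

monomialU : ℕ → ℕ → ℚ
monomialU n j = if n ℕ.≡ᵇ j then 1ℚ else 0ℚ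

monomialU-≢ : ∀ {n j} → n ≢ j → monomialU n j ≡ 0ℚ
monomialU-≢ {n} {j} n≢j with n ℕ.≡ᵇ j in n≡ᵇj
... | true  = ⊥-elim (n≢j (ℕ.≡ᵇ⇒≡ n j (subst T (sym n≡ᵇj) tt)))
... | false = refl

monomialU-diagonal : ∀ n → monomialU n n ≡ 1ℚ
monomialU-diagonal n with n ℕ.≡ᵇ n in n≡ᵇn
... | true  = refl
... | false = ⊥-elim (subst T n≡ᵇn (ℕ.≡⇒≡ᵇ n n refl))

-- The coefficients of Σⱼ k j · uʲ, where u = h(-1) + h(-2).
uCoeffs : (ℕ → ℚ) → Coeffs₂
uCoeffs k a b = k (a ℕ.+ b) * fromℕ (pascal a b)

uCoeffs-cong : ∀ {k k′} → (∀ j → k j ≡ k′ j) → uCoeffs k ≗₂ uCoeffs k′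
uCoeffs-cong k≗k′ a b = cong (_* fromℕ (pascal a b)) (k≗k′ (a ℕ.+ b))

mulX+mulY-uCoeffs : ∀ k → mulX (uCoeffs k) ⊕ mulY (uCoeffs k) ≗₂ uCoeffs (mulU k)
mulX+mulY-uCoeffs k zero    zero    = refl
mulX+mulY-uCoeffs k (suc a) zero    = trans (ℚ.+-identityʳ _) (cong (λ n → k (a ℕ.+ 0) * fromℕ n) (pascal-zeroʳ a))
mulX+mulY-uCoeffs k zero    (suc b) = ℚ.+-identityˡ _
mulX+mulY-uCoeffs k (suc a) (suc b) = begin
  k (a ℕ.+ suc b) * fromℕ (pascal a (suc b)) + k (suc a ℕ.+ b) * fromℕ (pascal (suc a) b)
    ≡⟨ cong (λ n → k n * fromℕ (pascal a (suc b)) + k (suc a ℕ.+ b) * fromℕ (pascal (suc a) b)) (ℕ.+-suc a b) ⟩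
  k (suc a ℕ.+ b) * fromℕ (pascal a (suc b)) + k (suc a ℕ.+ b) * fromℕ (pascal (suc a) b)
    ≡⟨ ℚ.*-distribˡ-+ (k (suc a ℕ.+ b)) (fromℕ (pascal a (suc b))) (fromℕ (pascal (suc a) b)) ⟨
  k (suc a ℕ.+ b) * (fromℕ (pascal a (suc b)) + fromℕ (pascal (suc a) b))
    ≡⟨ cong (k (suc a ℕ.+ b) *_) (fromℕ-+ (pascal a (suc b)) (pascal (suc a) b)) ⟨
  k (suc a ℕ.+ b) * fromℕ (pascal (suc a) (suc b))
    ≡⟨ cong (λ n → mulU k n * fromℕ (pascal (suc a) (suc b))) (ℕ.+-suc (suc a) b) ⟨
  mulU k (suc a ℕ.+ suc b) * fromℕ (pascal (suc a) (suc b))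
    ∎
  where open ≡-Reasoning

∂Y-uCoeffs : ∀ k → ∂Y (uCoeffs k) ≗₂ uCoeffs (∂U k)
∂Y-uCoeffs k a b = begin
  (k (a ℕ.+ suc b) * fromℕ (pascal a (suc b))) * fromℕ (suc b)
    ≡⟨ cong (λ n → (k n * fromℕ (pascal a (suc b))) * fromℕ (suc b)) (ℕ.+-suc a b) ⟩
  (k (suc (a ℕ.+ b)) * fromℕ (pascal a (suc b))) * fromℕ (suc b)
    ≡⟨ ℚ.*-assoc (k (suc (a ℕ.+ b))) (fromℕ (pascal a (suc b))) (fromℕ (suc b)) ⟩
  k (suc (a ℕ.+ b)) * (fromℕ (pascal a (suc b)) * fromℕ (suc b))
    ≡⟨ cong (k (suc (a ℕ.+ b)) *_) (trans (sym (fromℕ-* (pascal a (suc b)) (suc b)))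
                                  (trans (cong fromℕ (pascal-absorbʳ a b)) (fromℕ-* (pascal a b) (suc (a ℕ.+ b))))) ⟩
  k (suc (a ℕ.+ b)) * (fromℕ (pascal a b) * fromℕ (suc (a ℕ.+ b)))
    ≡⟨ +-*-Solver.solve 3 (λ x y z → x :* (y :* z) := (x :* z) :* y) refl
                          (k (suc (a ℕ.+ b))) (fromℕ (pascal a b)) (fromℕ (suc (a ℕ.+ b))) ⟩
  (k (suc (a ℕ.+ b)) * fromℕ (suc (a ℕ.+ b))) * fromℕ (pascal a b)
    ∎
  where open ≡-Reasoning

raise-uCoeffs : ∀ c k → raise c (uCoeffs k) ≗₂ uCoeffs (λ j → mulU k j + c * ∂U k j)
raise-uCoeffs c k a b = begin
  (mulX (uCoeffs k) ⊕ mulY (uCoeffs k)) a b + c * ∂Y (uCoeffs k) a b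
    ≡⟨ cong₂ (λ x y → x + c * y) (mulX+mulY-uCoeffs k a b) (∂Y-uCoeffs k a b) ⟩
  mulU k (a ℕ.+ b) * P + c * (∂U k (a ℕ.+ b) * P)
    ≡⟨ +-*-Solver.solve 4 (λ x c y p → x :* p :+ c :* (y :* p) := (x :+ c :* y) :* p) refl
                          (mulU k (a ℕ.+ b)) c (∂U k (a ℕ.+ b)) P ⟩
  (mulU k (a ℕ.+ b) + c * ∂U k (a ℕ.+ b)) * P
    ∎
  where
  open ≡-Reasoning
  P = fromℕ (pascal a b)

-- hermite c n j is the coefficient of uʲ in (u + c d/du)ⁿ 1.
hermite : ℚ → ℕ → ℕ → ℚ
hermite c zero      = monomialU 0
hermite c (suc n) j = mulU (hermite c n) j + c * ∂U (hermite c n) j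

vac-≈₂ : vac ≈₂ uCoeffs (monomialU 0)
vac-≈₂ .coeff≡ []               = refl
vac-≈₂ .coeff≡ (zero ∷ [])      = refl
vac-≈₂ .coeff≡ (suc _ ∷ [])     = refl
vac-≈₂ .coeff≡ (zero ∷ zero ∷ m) with anyPositive m in m⁺
... | true  = cong (_+ 0ℚ) (termCoeff-≉ₘ [] (0 ∷ 0 ∷ m) 1ℚ λ []≈m →
                case trans (sym ([]≈ₘ⇒¬anyPositive m ([]≈m ∘ suc ∘ suc))) m⁺ of λ ())
... | false = cong (_+ 0ℚ) (termCoeff-≈ₘ [] (0 ∷ 0 ∷ m) 1ℚ λ { zero → refl ; (suc zero) → refl
                                                              ; (suc (suc i)) → ¬anyPositive⇒[]≈ₘ m m⁺ i })
vac-≈₂ .coeff≡ m@(suc a ∷ b ∷ _) =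
  trans (cong (_+ 0ℚ) (termCoeff-≉ₘ [] m 1ℚ λ []≈m → case []≈m 0 of λ ()))
        (sym (coeff₂-≡0 (uCoeffs (monomialU 0)) m (ℚ.*-zeroˡ (fromℕ (pascal (suc a) b)))))
vac-≈₂ .coeff≡ m@(zero ∷ suc b ∷ _) =
  trans (cong (_+ 0ℚ) (termCoeff-≉ₘ [] m 1ℚ λ []≈m → case []≈m 1 of λ ()))
        (sym (coeff₂-≡0 (uCoeffs (monomialU 0)) m (ℚ.*-zeroˡ (fromℕ (pascal 0 (suc b))))))

iter-hBr2-≈₂ : ∀ n → iter hBr2 n vac ≈₂ uCoeffs (hermite κ n)
iter-hBr2-≈₂ zero    = vac-≈₂
iter-hBr2-≈₂ (suc n) = ≈₂-cong (hBr2-≈₂ (iter-hBr2-≈₂ n)) (raise-uCoeffs κ (hermite κ n))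

iter-hSum-≈₂ : ∀ n → iter hSum n vac ≈₂ uCoeffs (monomialU n)
iter-hSum-≈₂ zero    = vac-≈₂
iter-hSum-≈₂ (suc n) = ≈₂-cong (hSum-≈₂ (iter-hSum-≈₂ n)) λ a b →
  trans (ℚ.+-comm (mulY G a b) (mulX G a b))
        (trans (mulX+mulY-uCoeffs (monomialU n) a b) (uCoeffs-cong mulU-monomialU a b))
  where
  G = uCoeffs (monomialU n)
  mulU-monomialU : ∀ j → mulU (monomialU n) j ≡ monomialU (suc n) j
  mulU-monomialU zero    = refl
  mulU-monomialU (suc j) = refl

double : ℕ → ℕ
double zero    = 0
double (suc n) = suc (suc (double n))

double≡2* : ∀ n → double n ≡ 2 ℕ.* n
double≡2* zero    = refl
double≡2* (suc n) = trans (cong (suc ∘ suc) (double≡2* n)) (sym (ℕ.*-suc 2 n))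

double-+ : ∀ m n → double (m ℕ.+ n) ≡ double m ℕ.+ double n
double-+ zero    n = refl
double-+ (suc m) n = cong (suc ∘ suc) (double-+ m n)

double≢suc-double : ∀ a b → double a ≢ suc (double b)
double≢suc-double (suc a) (suc b) eq = double≢suc-double a b (ℕ.suc-injective (ℕ.suc-injective eq))

2*≡double⇒≡ : ∀ {a b} → 2 ℕ.* a ≡ double b → a ≡ b
2*≡double⇒≡ {a} {b} eq = ℕ.*-cancelˡ-≡ a b 2 (trans eq (double≡2* b))

data Parity : ℕ → Set where
  even : ∀ t → Parity (double t)
  odd  : ∀ t → Parity (suc (double t))

parity : ∀ n → Parity n
parity zero    = even 0
parity (suc n) with parity n
... | even t = odd t
... | odd t  = even (suc t)

-- C(2l+j, 2l) (2l-1)!!, the number of matchings with l edges on 2l + j points.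
matchings : ℕ → ℕ → ℕ
matchings l j = pascal j (double l) ℕ.* oddFact l

2*+1≡suc-double : ∀ l → 2 ℕ.* l ℕ.+ 1 ≡ suc (double l)
2*+1≡suc-double l = trans (ℕ.+-comm (2 ℕ.* l) 1) (cong suc (sym (double≡2* l)))

matchings-suc-zero : ∀ l → matchings (suc l) 0 ≡ matchings l 1
matchings-suc-zero l = begin
  1 ℕ.* (oddFact l ℕ.* (2 ℕ.* l ℕ.+ 1))   ≡⟨ ℕ.*-identityˡ _ ⟩
  oddFact l ℕ.* (2 ℕ.* l ℕ.+ 1)           ≡⟨ cong (oddFact l ℕ.*_) (2*+1≡suc-double l) ⟩
  oddFact l ℕ.* suc (double l)            ≡⟨ ℕ.*-comm (oddFact l) (suc (double l)) ⟩
  suc (double l) ℕ.* oddFact l            ≡⟨ cong (ℕ._* oddFact l) (pascal-1ˡ (double l)) ⟨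
  pascal 1 (double l) ℕ.* oddFact l       ∎
  where open ≡-Reasoning

matchings-suc-suc : ∀ l j → matchings (suc l) (suc j) ≡ matchings (suc l) j ℕ.+ matchings l (2 ℕ.+ j) ℕ.* (2 ℕ.+ j)
matchings-suc-suc l j = begin
  (pascal j (2 ℕ.+ D) ℕ.+ pascal (suc j) (suc D)) ℕ.* oddFact (suc l)
    ≡⟨ ℕ.*-distribʳ-+ (oddFact (suc l)) (pascal j (2 ℕ.+ D)) (pascal (suc j) (suc D)) ⟩
  matchings (suc l) j ℕ.+ pascal (suc j) (suc D) ℕ.* (o ℕ.* (2 ℕ.* l ℕ.+ 1))
    ≡⟨ cong (λ s → matchings (suc l) j ℕ.+ pascal (suc j) (suc D) ℕ.* (o ℕ.* s)) (2*+1≡suc-double l) ⟩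
  matchings (suc l) j ℕ.+ pascal (suc j) (suc D) ℕ.* (o ℕ.* suc D)
    ≡⟨ cong (matchings (suc l) j ℕ.+_) (swap (pascal (suc j) (suc D)) o (suc D)) ⟩
  matchings (suc l) j ℕ.+ o ℕ.* (pascal (suc j) (suc D) ℕ.* suc D)
    ≡⟨ cong (λ x → matchings (suc l) j ℕ.+ o ℕ.* x) absorb ⟩
  matchings (suc l) j ℕ.+ o ℕ.* (pascal (2 ℕ.+ j) D ℕ.* (2 ℕ.+ j))
    ≡⟨ cong (matchings (suc l) j ℕ.+_) (swap o (pascal (2 ℕ.+ j) D) (2 ℕ.+ j)) ⟩
  matchings (suc l) j ℕ.+ pascal (2 ℕ.+ j) D ℕ.* (o ℕ.* (2 ℕ.+ j))
    ≡⟨ cong (matchings (suc l) j ℕ.+_) (ℕ.*-assoc (pascal (2 ℕ.+ j) D) o (2 ℕ.+ j)) ⟨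
  matchings (suc l) j ℕ.+ matchings l (2 ℕ.+ j) ℕ.* (2 ℕ.+ j)
    ∎
  where
  open ≡-Reasoning
  D = double l
  o = oddFact l
  swap : ∀ x y z → x ℕ.* (y ℕ.* z) ≡ y ℕ.* (x ℕ.* z)
  swap = ℕ-Solver.solve-∀
  absorb : pascal (suc j) (suc D) ℕ.* suc D ≡ pascal (2 ℕ.+ j) D ℕ.* (2 ℕ.+ j)
  absorb = trans (pascal-absorbʳ (suc j) D) (sym (pascal-absorbˡ (suc j) D))

hermite-suc-≡0 : ∀ c n j → mulU (hermite c n) j ≡ 0ℚ → hermite c n (suc j) ≡ 0ℚ → hermite c (suc n) j ≡ 0ℚ
hermite-suc-≡0 c n j shifted≡0 next≡0 = begin
  mulU (hermite c n) j + c * (hermite c n (suc j) * fromℕ (suc j))  ≡⟨ cong₂ (λ x y → x + c * (y * fromℕ (suc j)))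
                                                                            shifted≡0 next≡0 ⟩
  0ℚ + c * (0ℚ * fromℕ (suc j))                                     ≡⟨ ℚ.+-identityˡ _ ⟩
  c * (0ℚ * fromℕ (suc j))                                          ≡⟨ cong (c *_) (ℚ.*-zeroˡ (fromℕ (suc j))) ⟩
  c * 0ℚ                                                            ≡⟨ ℚ.*-zeroʳ c ⟩
  0ℚ                                                                ∎
  where open ≡-Reasoning

hermite-above : ∀ c {n j} → n < j → hermite c n j ≡ 0ℚ
hermite-above c {zero}  {suc j} _         = refl
hermite-above c {suc n} {suc j} (s≤s n<j) =
  hermite-suc-≡0 c n (suc j) (hermite-above c n<j) (hermite-above c (ℕ.m<n⇒m<1+n (ℕ.m<n⇒m<1+n n<j)))

hermite-diagonal : ∀ c n → hermite c n n ≡ 1ℚ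
hermite-diagonal c zero    = refl
hermite-diagonal c (suc n) = begin
  hermite c n n + c * (hermite c n (2 ℕ.+ n) * fromℕ (2 ℕ.+ n))
    ≡⟨ cong₂ (λ x y → x + c * (y * fromℕ (2 ℕ.+ n))) (hermite-diagonal c n) (hermite-above c (ℕ.m<n⇒m<1+n (ℕ.n<1+n n))) ⟩
  1ℚ + c * (0ℚ * fromℕ (2 ℕ.+ n))
    ≡⟨ cong (λ x → 1ℚ + c * x) (ℚ.*-zeroˡ (fromℕ (2 ℕ.+ n))) ⟩
  1ℚ + c * 0ℚ
    ≡⟨ cong (1ℚ +_) (ℚ.*-zeroʳ c) ⟩
  1ℚ
    ∎
  where open ≡-Reasoning

hermite-odd : ∀ c l j → hermite c (suc (double l ℕ.+ j)) j ≡ 0ℚ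
hermite-odd c zero    zero    = hermite-suc-≡0 c 0 0 refl refl
hermite-odd c zero    (suc j) =
  hermite-suc-≡0 c (suc j) (suc j) (hermite-odd c 0 j) (hermite-above c (ℕ.n<1+n (suc j)))
hermite-odd c (suc l) zero    = hermite-suc-≡0 c (suc (suc (double l ℕ.+ 0))) 0 refl
  (trans (cong (λ n → hermite c (suc n) 1) (sym (ℕ.+-suc (double l) 0))) (hermite-odd c l 1))
hermite-odd c (suc l) (suc j) = hermite-suc-≡0 c (suc (suc (double l ℕ.+ suc j))) (suc j)
  (trans (cong (λ n → hermite c (suc (suc n)) j) (ℕ.+-suc (double l) j)) (hermite-odd c (suc l) j))
  (trans (cong (λ n → hermite c (suc n) (2 ℕ.+ j)) (sym (ℕ.+-suc (double l) (suc j)))) (hermite-odd c l (2 ℕ.+ j)))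

hermite-even : ∀ c l j → hermite c (double l ℕ.+ j) j ≡ fromℕ (matchings l j) * c ^ l
hermite-even c zero    j       =
  trans (hermite-diagonal c j) (sym (cong (λ n → fromℕ (n ℕ.* 1) * 1ℚ) (pascal-zeroʳ j)))
hermite-even c (suc l) zero    = begin
  0ℚ + c * (hermite c (suc (double l ℕ.+ 0)) 1 * fromℕ 1)
    ≡⟨ cong (λ n → 0ℚ + c * (hermite c n 1 * fromℕ 1)) (ℕ.+-suc (double l) 0) ⟨
  0ℚ + c * (hermite c (double l ℕ.+ 1) 1 * fromℕ 1)
    ≡⟨ cong (λ x → 0ℚ + c * (x * fromℕ 1)) (hermite-even c l 1) ⟩
  0ℚ + c * ((fromℕ (matchings l 1) * c ^ l) * 1ℚ)
    ≡⟨ arith c (fromℕ (matchings l 1)) (c ^ l) ⟩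
  fromℕ (matchings l 1) * c ^ suc l
    ≡⟨ cong (λ n → fromℕ n * c ^ suc l) (matchings-suc-zero l) ⟨
  fromℕ (matchings (suc l) 0) * c ^ suc l
    ∎
  where
  open ≡-Reasoning
  arith : ∀ c m p → 0ℚ + c * ((m * p) * 1ℚ) ≡ m * (c * p)
  arith = +-*-Solver.solve 3 (λ c m p → con 0ℚ :+ c :* ((m :* p) :* con 1ℚ) := m :* (c :* p)) refl
hermite-even c (suc l) (suc j) = begin
  hermite c n′ j + c * (hermite c n′ (2 ℕ.+ j) * fromℕ (2 ℕ.+ j))
    ≡⟨ cong₂ (λ x y → x + c * (y * fromℕ (2 ℕ.+ j)))
             (trans (cong (λ n → hermite c (suc n) j) (ℕ.+-suc (double l) j)) (hermite-even c (suc l) j))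
             (trans (cong (λ n → hermite c n (2 ℕ.+ j)) (sym (ℕ.+-suc (double l) (suc j))))
                    (hermite-even c l (2 ℕ.+ j))) ⟩
  fromℕ m₁ * c ^ suc l + c * ((fromℕ m₂ * c ^ l) * fromℕ (2 ℕ.+ j))
    ≡⟨ +-*-Solver.solve 5 (λ a b s p c → a :* (c :* p) :+ c :* ((b :* p) :* s) := (a :+ b :* s) :* (c :* p)) refl
                          (fromℕ m₁) (fromℕ m₂) (fromℕ (2 ℕ.+ j)) (c ^ l) c ⟩
  (fromℕ m₁ + fromℕ m₂ * fromℕ (2 ℕ.+ j)) * c ^ suc l
    ≡⟨ cong (_* c ^ suc l) (trans (fromℕ-+ m₁ (m₂ ℕ.* (2 ℕ.+ j))) (cong (fromℕ m₁ +_) (fromℕ-* m₂ (2 ℕ.+ j)))) ⟨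
  fromℕ (m₁ ℕ.+ m₂ ℕ.* (2 ℕ.+ j)) * c ^ suc l
    ≡⟨ cong (λ n → fromℕ n * c ^ suc l) (matchings-suc-suc l j) ⟨
  fromℕ (matchings (suc l) (suc j)) * c ^ suc l
    ∎
  where
  open ≡-Reasoning
  n′ = suc (double l ℕ.+ suc j)
  m₁ = matchings (suc l) j
  m₂ = matchings l (2 ℕ.+ j)

hermite-≡0 : ∀ c n j → (∀ l → double l ℕ.+ j ≢ n) → hermite c n j ≡ 0ℚ
hermite-≡0 c n j notEven with j ℕ.≤? n
... | no j≰n = hermite-above c (ℕ.≰⇒> j≰n)
... | yes j≤n with n ∸ j | parity (n ∸ j) | ℕ.m∸n+n≡m j≤n
...   | .(double l)       | even l | d+j≡n = ⊥-elim (notEven l d+j≡n)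
...   | .(suc (double l)) | odd l  | d+j≡n = trans (cong (λ n → hermite c n j) (sym d+j≡n)) (hermite-odd c l j)

double-factorial : ∀ l → double l ! ≡ oddFact l ℕ.* (2 ℕ.^ l ℕ.* l !)
double-factorial zero    = refl
double-factorial (suc l) = begin
  suc (suc (double l)) ℕ.* (suc (double l) ℕ.* double l !)
    ≡⟨ cong (λ d → suc (suc d) ℕ.* (suc d ℕ.* double l !)) (double≡2* l) ⟩
  suc (suc (2 ℕ.* l)) ℕ.* (suc (2 ℕ.* l) ℕ.* double l !)
    ≡⟨ cong (λ x → suc (suc (2 ℕ.* l)) ℕ.* (suc (2 ℕ.* l) ℕ.* x)) (double-factorial l) ⟩
  suc (suc (2 ℕ.* l)) ℕ.* (suc (2 ℕ.* l) ℕ.* (oddFact l ℕ.* (2 ℕ.^ l ℕ.* l !)))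
    ≡⟨ arith (oddFact l) (2 ℕ.^ l) (l !) l ⟩
  oddFact l ℕ.* (2 ℕ.* l ℕ.+ 1) ℕ.* (2 ℕ.* 2 ℕ.^ l ℕ.* (l ! ℕ.+ l ℕ.* l !))
    ∎
  where
  open ≡-Reasoning
  arith : ∀ o p f l → suc (suc (2 ℕ.* l)) ℕ.* (suc (2 ℕ.* l) ℕ.* (o ℕ.* (p ℕ.* f)))
                    ≡ o ℕ.* (2 ℕ.* l ℕ.+ 1) ℕ.* (2 ℕ.* p ℕ.* (f ℕ.+ l ℕ.* f))
  arith = ℕ-Solver.solve-∀

240^l≡120^l*2^l : ∀ l → 240 ℕ.^ l ≡ 120 ℕ.^ l ℕ.* 2 ℕ.^ l
240^l≡120^l*2^l zero    = refl
240^l≡120^l*2^l (suc l) = trans (cong (240 ℕ.*_) (240^l≡120^l*2^l l)) (arith (120 ℕ.^ l) (2 ℕ.^ l))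
  where
  arith : ∀ a b → 240 ℕ.* (a ℕ.* b) ≡ 120 ℕ.* a ℕ.* (2 ℕ.* b)
  arith = ℕ-Solver.solve-∀

κ^l : ∀ l → κ ^ l ≡ negOnePow l * invNat (120 ℕ.^ l)
κ^l zero    = refl
κ^l (suc l) = begin
  κ * κ ^ l
    ≡⟨ cong (κ *_) (κ^l l) ⟩
  (- invNat 120) * (negOnePow l * invNat (120 ℕ.^ l))
    ≡⟨ arith (invNat 120) (negOnePow l) (invNat (120 ℕ.^ l)) ⟩
  negOnePow (suc l) * (invNat 120 * invNat (120 ℕ.^ l))
    ≡⟨ cong (negOnePow (suc l) *_) (invNat-* 120 (120 ℕ.^ l) {{_}} {{ℕ.m^n≢0 120 l}}) ⟨
  negOnePow (suc l) * invNat (120 ℕ.^ suc l)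
    ∎
  where
  open ≡-Reasoning
  arith : ∀ a s b → (- a) * (s * b) ≡ (- s) * (a * b)
  arith = +-*-Solver.solve 3 (λ a s b → (:- a) :* (s :* b) := (:- s) :* (a :* b)) refl

binomial≡pascal : ∀ l t → (2 ℕ.* (l ℕ.+ t)) C (2 ℕ.* l) ≡ pascal (double t) (double l)
binomial≡pascal l t = sym (begin
  pascal (double t) (double l)                 ≡⟨ pascal≡C (double t) (double l) ⟩
  (double t ℕ.+ double l) C double l           ≡⟨ cong₂ _C_ (sym (double-+ t l)) (double≡2* l) ⟩
  double (t ℕ.+ l) C (2 ℕ.* l)                 ≡⟨ cong (λ n → n C (2 ℕ.* l))
                                                       (trans (double≡2* (t ℕ.+ l)) (cong (2 ℕ.*_) (ℕ.+-comm t l))) ⟩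
  (2 ℕ.* (l ℕ.+ t)) C (2 ℕ.* l)                ∎)
  where open ≡-Reasoning

rhsCoeff≡matchings : ∀ l t → rhsCoeff (l ℕ.+ t) l ≡ fromℕ (matchings l (double t)) * κ ^ l
rhsCoeff≡matchings l t = begin
  fromℕ (((2 ℕ.* (l ℕ.+ t)) C (2 ℕ.* l)) ℕ.* (2 ℕ.* l) !) * (negOnePow l * invNat (240 ℕ.^ l ℕ.* l !))
    ≡⟨ cong₂ (λ x y → fromℕ x * (negOnePow l * invNat y))
             (cong₂ ℕ._*_ (binomial≡pascal l t) (trans (cong _! (sym (double≡2* l))) (double-factorial l)))
             (trans (cong (ℕ._* l !) (240^l≡120^l*2^l l)) (ℕ.*-assoc (120 ℕ.^ l) (2 ℕ.^ l) (l !))) ⟩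
  fromℕ (P ℕ.* (o ℕ.* N)) * (negOnePow l * invNat (120 ℕ.^ l ℕ.* N))
    ≡⟨ cong₂ (λ x y → x * (negOnePow l * y))
             (trans (fromℕ-* P (o ℕ.* N)) (cong (fromℕ P *_) (fromℕ-* o N)))
             (invNat-* (120 ℕ.^ l) N {{ℕ.m^n≢0 120 l}} {{N≢0}}) ⟩
  (fromℕ P * (fromℕ o * fromℕ N)) * (negOnePow l * (invNat (120 ℕ.^ l) * invNat N))
    ≡⟨ regroup (fromℕ P) (fromℕ o) (fromℕ N) (negOnePow l) (invNat (120 ℕ.^ l)) (invNat N) ⟩
  ((fromℕ P * fromℕ o) * (negOnePow l * invNat (120 ℕ.^ l))) * (fromℕ N * invNat N)
    ≡⟨ cong (((fromℕ P * fromℕ o) * (negOnePow l * invNat (120 ℕ.^ l))) *_) (fromℕ*invNat N {{N≢0}}) ⟩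
  ((fromℕ P * fromℕ o) * (negOnePow l * invNat (120 ℕ.^ l))) * 1ℚ
    ≡⟨ ℚ.*-identityʳ _ ⟩
  (fromℕ P * fromℕ o) * (negOnePow l * invNat (120 ℕ.^ l))
    ≡⟨ cong₂ _*_ (fromℕ-* P o) (κ^l l) ⟨
  fromℕ (matchings l (double t)) * κ ^ l
    ∎
  where
  open ≡-Reasoning
  P = pascal (double t) (double l)
  o = oddFact l
  N = 2 ℕ.^ l ℕ.* l !
  N≢0 : NonZero N
  N≢0 = ℕ.m*n≢0 (2 ℕ.^ l) (l !) {{ℕ.m^n≢0 2 l}} {{l ℕ.!≢0}}
  regroup : ∀ p o n s a b → (p * (o * n)) * (s * (a * b)) ≡ ((p * o) * (s * a)) * (n * b)
  regroup = +-*-Solver.solve 6 (λ p o n s a b → (p :* (o :* n)) :* (s :* (a :* b)) := ((p :* o) :* (s :* a)) :* (n :* b)) refl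

rhsU : ℕ → ℕ → ℚ
rhsU r s = sumTo (λ l → rhsCoeff r l * monomialU (2 ℕ.* (r ∸ l)) s) r

rhsU-≡0 : ∀ r s → (∀ l → 2 ℕ.* (r ∸ l) ≢ s) → rhsU r s ≡ 0ℚ
rhsU-≡0 r s ≢s = sumTo-zero _ r λ l _ → trans (cong (rhsCoeff r l *_) (monomialU-≢ (≢s l))) (ℚ.*-zeroʳ (rhsCoeff r l))

hermite≡rhsU-even : ∀ {r t} → t ≤ r → hermite κ (2 ℕ.* r) (double t) ≡ rhsU r (double t)
hermite≡rhsU-even {r} {t} t≤r = begin
  hermite κ (2 ℕ.* r) (double t)                         ≡⟨ cong (λ n → hermite κ n (double t)) 2r≡2l₀+2t ⟩
  hermite κ (double l₀ ℕ.+ double t) (double t)          ≡⟨ hermite-even κ l₀ (double t) ⟩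
  fromℕ (matchings l₀ (double t)) * κ ^ l₀               ≡⟨ rhsCoeff≡matchings l₀ t ⟨
  rhsCoeff (l₀ ℕ.+ t) l₀                                 ≡⟨ cong (λ n → rhsCoeff n l₀) l₀+t≡r ⟩
  rhsCoeff r l₀                                          ≡⟨ ℚ.*-identityʳ (rhsCoeff r l₀) ⟨
  rhsCoeff r l₀ * 1ℚ                                     ≡⟨ cong (rhsCoeff r l₀ *_) monomial-l₀≡1 ⟨
  rhsCoeff r l₀ * monomialU (2 ℕ.* (r ∸ l₀)) (double t)  ≡⟨ sumTo-single _ r l₀ others beyond ⟨
  rhsU r (double t)                                      ∎
  where
  open ≡-Reasoning
  l₀ = r ∸ t
  l₀+t≡r : l₀ ℕ.+ t ≡ r
  l₀+t≡r = ℕ.m∸n+n≡m t≤r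
  beyond : r < l₀ → rhsCoeff r l₀ * monomialU (2 ℕ.* (r ∸ l₀)) (double t) ≡ 0ℚ
  beyond r<l₀ = ⊥-elim (ℕ.<⇒≱ r<l₀ (ℕ.m∸n≤m r t))
  2r≡2l₀+2t : 2 ℕ.* r ≡ double l₀ ℕ.+ double t
  2r≡2l₀+2t = trans (sym (double≡2* r)) (trans (cong double (sym l₀+t≡r)) (double-+ l₀ t))
  monomial-l₀≡1 : monomialU (2 ℕ.* (r ∸ l₀)) (double t) ≡ 1ℚ
  monomial-l₀≡1 = trans (cong (λ n → monomialU n (double t))
                           (trans (cong (2 ℕ.*_) (ℕ.m∸[m∸n]≡n t≤r)) (sym (double≡2* t))))
                     (monomialU-diagonal (double t))
  others : ∀ l → l ≤ r → l ≢ l₀ → rhsCoeff r l * monomialU (2 ℕ.* (r ∸ l)) (double t) ≡ 0ℚ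
  others l l≤r l≢l₀ = trans (cong (rhsCoeff r l *_) (monomialU-≢ {2 ℕ.* (r ∸ l)} {double t} λ eq →
                              l≢l₀ (trans (sym (ℕ.m∸[m∸n]≡n l≤r)) (cong (r ∸_) (2*≡double⇒≡ {r ∸ l} eq)))))
                            (ℚ.*-zeroʳ (rhsCoeff r l))

hermite≡rhsU : ∀ r s → hermite κ (2 ℕ.* r) s ≡ rhsU r s
hermite≡rhsU r s with parity s
... | odd t = trans (hermite-≡0 κ (2 ℕ.* r) (suc (double t)) oddOffset) (sym (rhsU-≡0 r (suc (double t)) notEven))
  where
  notEven : ∀ l → 2 ℕ.* (r ∸ l) ≢ suc (double t)
  notEven l eq = double≢suc-double (r ∸ l) t (trans (double≡2* (r ∸ l)) eq)
  oddOffset : ∀ l → double l ℕ.+ suc (double t) ≢ 2 ℕ.* r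
  oddOffset l eq = double≢suc-double r (l ℕ.+ t) (begin
    double r                     ≡⟨ double≡2* r ⟩
    2 ℕ.* r                      ≡⟨ eq ⟨
    double l ℕ.+ suc (double t)  ≡⟨ ℕ.+-suc (double l) (double t) ⟩
    suc (double l ℕ.+ double t)  ≡⟨ cong suc (double-+ l t) ⟨
    suc (double (l ℕ.+ t))       ∎)
    where open ≡-Reasoning
... | even t with t ℕ.≤? r
...   | yes t≤r = hermite≡rhsU-even t≤r
...   | no  t≰r = trans (hermite-above κ 2r<2t) (sym (rhsU-≡0 r (double t) tooLarge))
  where
  2r<2t : 2 ℕ.* r < double t
  2r<2t = subst (2 ℕ.* r <_) (sym (double≡2* t)) (ℕ.*-monoʳ-< 2 (ℕ.≰⇒> t≰r))
  tooLarge : ∀ l → 2 ℕ.* (r ∸ l) ≢ double t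
  tooLarge l eq = t≰r (subst (_≤ r) (2*≡double⇒≡ eq) (ℕ.m∸n≤m r l))

rhsSum-≈₂ : ∀ r → concatMap (λ l → scale (rhsCoeff r l) (iter hSum (2 ℕ.* (r ∸ l)) vac)) (upTo (suc r))
                  ≈₂ uCoeffs (rhsU r)
rhsSum-≈₂ r = ≈₂-cong (concatMap-scale-≈₂ (rhsCoeff r) (λ l → iter hSum (2 ℕ.* (r ∸ l)) vac) (λ l → uCoeffs (u^ l)) r
                                          (λ l → iter-hSum-≈₂ (2 ℕ.* (r ∸ l))))
                      collect
  where
  u^ : ℕ → ℕ → ℚ
  u^ l = monomialU (2 ℕ.* (r ∸ l))
  collect : (λ a b → sumTo (λ l → rhsCoeff r l * uCoeffs (u^ l) a b) r) ≗₂ uCoeffs (rhsU r)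
  collect a b = trans (sym (sumTo-cong r λ l → ℚ.*-assoc (rhsCoeff r l) (u^ l (a ℕ.+ b)) (fromℕ (pascal a b))))
                      (sumTo-*ʳ (λ l → rhsCoeff r l * u^ l (a ℕ.+ b)) (fromℕ (pascal a b)) r)

alpha-≈₂ : ∀ r → alpha r ≈₂ pref r ⊙ uCoeffs (rhsU r)
alpha-≈₂ r = scale-≈₂ (pref r) (≈₂-cong (iter-hBr2-≈₂ (2 ℕ.* r)) (uCoeffs-cong (hermite≡rhsU r)))

rhs-≈₂ : ∀ r → rhs r ≈₂ pref r ⊙ uCoeffs (rhsU r)
rhs-≈₂ r = scale-≈₂ (pref r) (rhsSum-≈₂ r)

-- The identity also holds for r = 0.
lemma4p4 : (r : ℕ) → 1 ≤ r → alpha r ≈S rhs r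
lemma4p4 r _ m = trans (alpha-≈₂ r .coeff≡ m) (sym (rhs-≈₂ r .coeff≡ m))
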